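{- Let $S$ be an inverse-closed set of distinct non-zero integers with $|S^+|=2$ (so $\mathrm{Cay}(\mathbb{Z},S)$ is $4$-valent). Then $\mathrm{Cay}(\mathbb{Z},S)$ is Hamilton-decomposable if and only if it is admissible.
   Context: For an inverse-closed set $S$ of distinct non-zero integers (i.e. $s\in S$ iff $-s\in S$), $\mathrm{Cay}(\mathbb{Z},S)$ is the simple graph with vertex set $\mathbb{Z}$ and edge set $\{\{g,g+s\} : g\in\mathbb{Z}, s\in S\}$, and $S^+=\{a\in S : a>0\}$. A (two-way-infinite) Hamilton path of an infinite graph is a connected spanning $2$-valent subgraph. A Hamilton decomposition is a set of pairwise edge-disjoint Hamilton paths whose union contains all edges; a graph is Hamilton-decomposable if it has one. $\mathrm{Cay}(\mathbb{Z},S)$ is called admissible if (i) $S=\emptyset$ or $\gcd(S)=1$, and (ii) if $S$ is finite then $\sum_{a\in S^+} a \equiv |S^+| \pmod 2$. -}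

module Defs where

open import Level using (Level; _⊔_) renaming (suc to lsuc; zero to lzero)
open import Data.Nat as ℕ using (ℕ; _%_)
open import Data.Nat.GCD using (gcd)
open import Data.Integer as ℤ using (ℤ; +_; -_; _-_)
open import Data.Product using (Σ; ∃; ∃-syntax; _×_; _,_)
open import Data.Sum using (_⊎_)
open import Relation.Nullary using (¬_)
open import Relation.Binary.PropositionalEquality using (_≡_; _≢_)
open import Relation.Binary.Construct.Closure.ReflexiveTransitive using (Star)

Cay : (ℤ → Set) → ℤ → ℤ → Set
Cay S x y = S (y - x)

-- A (spanning) subgraph of a graph with adjacency Adj on vertex set ℤ
-- is a symmetric relation E contained in Adj (its edge set); the vertex
-- set is all of ℤ, so every subgraph considered here is spanning.
record Subgraph (Adj : ℤ → ℤ → Set) : Set₁ where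
  field
    E       : ℤ → ℤ → Set
    E⊆Adj   : ∀ {x y} → E x y → Adj x y
    E-sym   : ∀ {x y} → E x y → E y x

TwoValent : (ℤ → ℤ → Set) → Set
TwoValent E = ∀ v → ∃[ u ] ∃[ w ] (u ≢ w × E v u × E v w × (∀ z → E v z → z ≡ u ⊎ z ≡ w))

Connected : (ℤ → ℤ → Set) → Set
Connected E = ∀ x y → Star E x y

-- Two-way-infinite Hamilton path: connected spanning 2-valent subgraph.
IsHamiltonPath : {Adj : ℤ → ℤ → Set} → Subgraph Adj → Set
IsHamiltonPath H = TwoValent (Subgraph.E H) × Connected (Subgraph.E H)

record HamiltonDecomposition (Adj : ℤ → ℤ → Set) : Set₁ where
  field
    I        : Set
    path     : I → Subgraph Adj
    isHam    : ∀ i → IsHamiltonPath (path i)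
    disjoint : ∀ i j → i ≢ j → ∀ x y →
               ¬ (Subgraph.E (path i) x y × Subgraph.E (path j) x y)
    covers   : ∀ x y → Adj x y → ∃[ i ] Subgraph.E (path i) x y

HamiltonDecomposable : (ℤ → ℤ → Set) → Set₁
HamiltonDecomposable Adj = HamiltonDecomposition Adj

S₂ : ℕ → ℕ → ℤ → Set
S₂ a b z = z ≡ + a ⊎ z ≡ - (+ a) ⊎ z ≡ + b ⊎ z ≡ - (+ b)

-- Admissibility of Cay(ℤ,S) for S = {±a,±b} (S nonempty and finite):
-- (i) gcd(S) = gcd(a,b) = 1, (ii) a + b ≡ |S⁺| = 2 (mod 2).
Admissible₂ : ℕ → ℕ → Set
Admissible₂ a b = gcd a b ≡ 1 × (a ℕ.+ b) % 2 ≡ 2 % 2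

-- Write S = {±a, ±b} with 0 < a < b.
--
-- Necessity. A Hamilton path is connected and uses only steps from S, so gcd(a, b) divides every
-- integer. For the parity condition, enumerate a Hamilton path by a bijection h : ℤ → ℤ. Its steps
-- have length at most b, so each tail of h eventually stays on one side of 0, and since h is onto,
-- the two tails end on opposite sides. Hence the path crosses between the negative and the
-- non-negative integers an odd number of times. Every crossing edge has its negative end in the
-- window -b, …, -1, so summing over the window the number of negative neighbours of each vertex
-- gives an odd total. Two edge-disjoint Hamilton paths use all four edges at every vertex, so for
-- two paths of a decomposition the two totals add up to the number of negative Cayley neighbours
-- of the window, which is 2b + (b - a). Hence b - a is even.
--
-- Sufficiency. Now a and b are odd; let d = b - a and N = 2d. The first path takes the a-edge
-- {x, x + a} unless N divides x or x - b, and the b-edge {x, x + b} when N divides x or x - a; the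
-- second path takes all other edges, which is the same construction with a and b exchanged. As N
-- is coprime to a, b and divides neither a, b nor b - a, every vertex gets exactly two edges. In
-- coordinates v = X a + Y b the path through 0 zigzags along rows of X + Y of lengths d - 1 and
-- d + 1, and shifting (X, Y) by multiples of (b, -a) moves every integer onto one of these rows.

module Submission where

open import Defs
open import Data.Nat using (ℕ; _<_)
open import Function.Bundles using (_⇔_; mk⇔)

open import Data.Bool using (Bool; true; false; not; _∧_; _xor_)
open import Data.Bool.Properties
  using (not-distribˡ-xor; xor-assoc; xor-comm; xor-same; xor-identityʳ; ∧-comm; ∧-zeroʳ; ∧-idem; ∧-distribˡ-xor)
open import Data.Empty using (⊥; ⊥-elim)
open import Data.Integer as ℤ using (ℤ; +_; -[1+_]; +[1+_]; _+_; _-_; _*_; -_; ∣_∣; 0ℤ; 1ℤ; -1ℤ)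
import Data.Integer.Coprimality as ℤC
open import Data.Integer.Divisibility.Signed using (_∣_; _∣?_; divides; ∣m∣n⇒∣m+n; ∣m∣n⇒∣m-n; ∣m⇒∣-m; ∣⇒∣ᵤ; ∣ᵤ⇒∣)
open import Data.Integer.DivMod using (_%ℕ_; _/ℕ_; a≡a%ℕn+[a/ℕn]*n; n%ℕd<d)
import Data.Integer.Properties as ℤP
open import Algebra.Properties.AbelianGroup ℤP.+-0-abelianGroup using () renaming (∙-cancelˡ to +-cancelˡ)
open import Data.Integer.Tactic.RingSolver using (solve-∀)
open import Data.List using (List; []; _∷_; _++_; length)
import Data.List.Membership.DecPropositional as DecMembership
open import Data.List.Membership.Propositional using (_∈_; _∉_; find)
open import Data.List.Membership.Propositional.Properties using (∈-∃++; ∈-++⁻; ∈-++⁺ˡ; ∈-++⁺ʳ)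
open import Data.List.Properties using (length-++)
open import Data.List.Relation.Unary.All as All using (All; all?; []; _∷_)
open import Data.List.Relation.Unary.All.Properties using (¬All⇒Any¬; ¬Any⇒All¬)
open import Data.List.Relation.Unary.Any using (here; there)
open import Data.List.Relation.Unary.Unique.Propositional using (Unique; []; _∷_)
open import Data.Nat as ℕ using (zero; suc)
import Data.Nat.Coprimality as ℕC
import Data.Nat.Divisibility as ℕD
open import Data.Nat.DivMod using (_%_; m*n%n≡0; [m+kn]%n≡m%n)
open import Data.Nat.GCD using (gcd; gcd-greatest; gcd[m,n]∣m; gcd[m,n]∣n)
import Data.Nat.GCD as GCD
import Data.Nat.Properties as ℕP
import Data.Nat.Tactic.RingSolver as ℕ-Solver
open import Data.Product using (∃; ∃-syntax; _×_; _,_; proj₁; proj₂)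
open import Data.Sum using (_⊎_; inj₁; inj₂; [_,_]′)
open import Function using (_∘_; _∘′_; id)
open import Function.Definitions using (Injective)
open import Relation.Binary.Construct.Closure.ReflexiveTransitive using (Star; ε; _◅_; _◅◅_; reverse)
open import Relation.Binary.Definitions using (DecidableEquality)
open import Relation.Binary.PropositionalEquality
open import Relation.Nullary using (¬_; yes; no; does)
open import Relation.Nullary.Decidable using (dec-true; dec-false)

i≡j+k⇒j≡i-k : ∀ {i j k} → i ≡ j + k → j ≡ i - k
i≡j+k⇒j≡i-k {j = j} {k} refl = solve j k
  where solve : ∀ j k → j ≡ j + k - k
        solve = solve-∀

i≡j-k⇒j≡i+k : ∀ {i j k} → i ≡ j - k → j ≡ i + k
i≡j-k⇒j≡i+k {j = j} {k} refl = solve j k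
  where solve : ∀ j k → j ≡ j - k + k
        solve = solve-∀

i-j≡k⇒i≡j+k : ∀ {i j k} → i - j ≡ k → i ≡ j + k
i-j≡k⇒i≡j+k {i} {j} refl = solve i j
  where solve : ∀ i j → i ≡ j + (i - j)
        solve = solve-∀

same-step : ∀ x {y i j} → y ≡ x + i → y ≡ x + j → i ≡ j
same-step x y≡x+i y≡x+j = +-cancelˡ x _ _ (trans (sym y≡x+i) y≡x+j)

pos≢neg : ∀ {i j} → 0ℤ ℤ.< i → 0ℤ ℤ.< j → i ≢ - j
pos≢neg {+ suc m} {+ suc n} _ _ ()
pos≢neg {+ _} {+ zero} _ (ℤ.+<+ ())

∣-combination : ∀ {N x y z} → N ∣ x → N ∣ y → x - y ≡ z → N ∣ z
∣-combination N∣x N∣y refl = ∣m∣n⇒∣m-n N∣x N∣y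

∤-pos : ∀ {N c} → 0 ℕ.< c → c ℕ.< N → ¬ (+ N ∣ + c)
∤-pos {N} {suc c} _ c<N N∣c = ℕP.<⇒≱ c<N (ℕD.∣⇒≤ (∣⇒∣ᵤ N∣c))

∤-neg : ∀ {N c} → 0 ℕ.< c → c ℕ.< N → ¬ (+ N ∣ - + c)
∤-neg {N} {c} 0<c c<N N∣-c = ∤-pos 0<c c<N (subst (+ N ∣_) (ℤP.neg-involutive (+ c)) (∣m⇒∣-m N∣-c))

ℤ-even-or-odd : ∀ Y → ∃[ u ] (Y ≡ + 2 * u ⊎ Y ≡ + 2 * u + 1ℤ)
ℤ-even-or-odd Y with Y %ℕ 2 | a≡a%ℕn+[a/ℕn]*n Y 2 | n%ℕd<d Y 2
... | 0 | Y≡ | _ = Y /ℕ 2 , inj₁ (trans Y≡ (solve (Y /ℕ 2)))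
  where solve : ∀ u → + 0 + u * + 2 ≡ + 2 * u
        solve = solve-∀
... | 1 | Y≡ | _ = Y /ℕ 2 , inj₂ (trans Y≡ (solve (Y /ℕ 2)))
  where solve : ∀ u → + 1 + u * + 2 ≡ + 2 * u + 1ℤ
        solve = solve-∀
... | suc (suc _) | _ | ℕ.s≤s (ℕ.s≤s ())

even-or-odd : ∀ n → ∃[ t ] (n ≡ t ℕ.+ t ⊎ n ≡ suc (t ℕ.+ t))
even-or-odd zero = 0 , inj₁ refl
even-or-odd (suc n) with even-or-odd n
... | t , inj₁ refl = t , inj₂ refl
... | t , inj₂ refl = suc t , inj₁ (cong suc (sym (ℕP.+-suc t t)))

ℤ-induction : ∀ (P : ℤ → Set) i → P i → (∀ j → P j → P (ℤ.suc j)) → (∀ j → P j → P (ℤ.pred j)) → ∀ k → P k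
ℤ-induction P i Pi up down k = subst P (lemma k i) (from (k - i))
  where
  from : ∀ d → P (d + i)
  from (+ zero) = subst P (sym (ℤP.+-identityˡ i)) Pi
  from (+ suc n) = subst P (sym (ℤP.+-assoc 1ℤ (+ n) i)) (up _ (from (+ n)))
  from -[1+ zero ] = subst P (sym (ℤP.+-assoc -1ℤ (+ 0) i)) (down _ (from (+ zero)))
  from -[1+ suc n ] = subst P (sym (ℤP.+-assoc -1ℤ -[1+ n ] i)) (down _ (from -[1+ n ]))
  lemma : ∀ k i → k - i + i ≡ k
  lemma = solve-∀

finite-bound : ∀ (f : ℕ → ℤ) n → ∃[ M ] (∀ r → r ℕ.< n → ∣ f r ∣ ℕ.≤ M)
finite-bound f zero = 0 , λ _ ()
finite-bound f (suc n) with finite-bound f n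
... | M , bound = M ℕ.⊔ ∣ f n ∣ , λ r r<1+n → [ below , at ]′ (ℕP.m<1+n⇒m<n∨m≡n r<1+n)
  where
  below : ∀ {r} → r ℕ.< n → ∣ f r ∣ ℕ.≤ M ℕ.⊔ ∣ f n ∣
  below r<n = ℕP.≤-trans (bound _ r<n) (ℕP.m≤m⊔n M _)
  at : ∀ {r} → r ≡ n → ∣ f r ∣ ℕ.≤ M ℕ.⊔ ∣ f n ∣
  at refl = ℕP.m≤n⊔m M _

bounded-on-ball : ∀ (f : ℤ → ℤ) B → ∃[ M ] (∀ k → ∣ k ∣ ℕ.≤ B → ∣ f k ∣ ℕ.≤ M)
bounded-on-ball f B with finite-bound (λ r → f (+ r)) (suc B) | finite-bound (λ r → f (- + r)) (suc B)
... | M₊ , bound₊ | M₋ , bound₋ = M₊ ℕ.⊔ M₋ , bound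
  where
  bound : ∀ k → ∣ k ∣ ℕ.≤ B → ∣ f k ∣ ℕ.≤ M₊ ℕ.⊔ M₋
  bound (+ n) n≤B = ℕP.≤-trans (bound₊ n (ℕ.s≤s n≤B)) (ℕP.m≤m⊔n M₊ M₋)
  bound -[1+ n ] n<B = ℕP.≤-trans (bound₋ (suc n) (ℕ.s≤s n<B)) (ℕP.m≤n⊔m M₊ M₋)

module _ {A : Set} where

  unique-⊆⇒length≤ : ∀ {xs ys : List A} → Unique xs → (∀ {x} → x ∈ xs → x ∈ ys) → length xs ℕ.≤ length ys
  unique-⊆⇒length≤ [] _ = ℕ.z≤n
  unique-⊆⇒length≤ {x ∷ xs} {ys} (x≢xs ∷ u) xs⊆ys with ∈-∃++ (xs⊆ys (here refl))
  ... | ys₁ , ys₂ , refl = begin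
    suc (length xs)               ≤⟨ ℕ.s≤s (unique-⊆⇒length≤ u xs⊆ys₁ys₂) ⟩
    suc (length (ys₁ ++ ys₂))     ≡⟨ cong suc (length-++ ys₁) ⟩
    suc (length ys₁ ℕ.+ length ys₂) ≡⟨ sym (ℕP.+-suc (length ys₁) _) ⟩
    length ys₁ ℕ.+ length (x ∷ ys₂) ≡⟨ sym (length-++ ys₁) ⟩
    length (ys₁ ++ x ∷ ys₂)       ∎
    where
    open ℕP.≤-Reasoning
    xs⊆ys₁ys₂ : ∀ {y} → y ∈ xs → y ∈ ys₁ ++ ys₂
    xs⊆ys₁ys₂ y∈xs with ∈-++⁻ ys₁ (xs⊆ys (there y∈xs))
    ... | inj₁ y∈ys₁ = ∈-++⁺ˡ y∈ys₁
    ... | inj₂ (here refl) = ⊥-elim (All.lookup x≢xs y∈xs refl)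
    ... | inj₂ (there y∈ys₂) = ∈-++⁺ʳ ys₁ y∈ys₂

module _ {A : Set} (_≟_ : DecidableEquality A) where

  open DecMembership _≟_ using (_∈?_)

  ∃-outside : ∀ {xs ys} → Unique xs → length ys ℕ.< length xs → ∃ λ x → x ∈ xs × x ∉ ys
  ∃-outside {xs} {ys} u ys<xs with all? (_∈? ys) xs
  ... | yes xs⊆ys = ⊥-elim (ℕP.<⇒≱ ys<xs (unique-⊆⇒length≤ u (All.lookup xs⊆ys)))
  ... | no xs⊈ys with find (¬All⇒Any¬ (_∈? ys) xs xs⊈ys)
  ...   | x , x∈xs , x∉ys = x , x∈xs , x∉ys

  ⊆-saturated : ∀ {xs ys} → Unique xs → (∀ {x} → x ∈ xs → x ∈ ys) → length ys ℕ.≤ length xs →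
                ∀ {y} → y ∈ ys → y ∈ xs
  ⊆-saturated {xs} {ys} u xs⊆ys ys≤xs {y} y∈ys with y ∈? xs
  ... | yes y∈xs = y∈xs
  ... | no y∉xs = ⊥-elim (ℕP.<⇒≱ (unique-⊆⇒length≤ (¬Any⇒All¬ xs y∉xs ∷ u) y∷xs⊆ys) ys≤xs)
    where
    y∷xs⊆ys : ∀ {z} → z ∈ y ∷ xs → z ∈ ys
    y∷xs⊆ys (here refl) = y∈ys
    y∷xs⊆ys (there z∈xs) = xs⊆ys z∈xs

-- Parity sums

true≢false : true ≢ false
true≢false ()

isOdd : ℕ → Bool
isOdd zero = false
isOdd (suc n) = not (isOdd n)

⨁ : {A : Set} → List A → (A → Bool) → Bool
⨁ [] f = false
⨁ (x ∷ xs) f = f x xor ⨁ xs f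

module _ {A : Set} where

  ⨁-cong : ∀ xs {f g : A → Bool} → (∀ {x} → x ∈ xs → f x ≡ g x) → ⨁ xs f ≡ ⨁ xs g
  ⨁-cong [] f≗g = refl
  ⨁-cong (x ∷ xs) f≗g = cong₂ _xor_ (f≗g (here refl)) (⨁-cong xs (f≗g ∘ there))

  ⨁-false : ∀ (xs : List A) → ⨁ xs (λ _ → false) ≡ false
  ⨁-false [] = refl
  ⨁-false (x ∷ xs) = ⨁-false xs

  ⨁-true : ∀ (xs : List A) → ⨁ xs (λ _ → true) ≡ isOdd (length xs)
  ⨁-true [] = refl
  ⨁-true (x ∷ xs) = cong not (⨁-true xs)

  ⨁-xor : ∀ xs (f g : A → Bool) → ⨁ xs (λ x → f x xor g x) ≡ ⨁ xs f xor ⨁ xs g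
  ⨁-xor [] f g = refl
  ⨁-xor (x ∷ xs) f g = begin
    (f x xor g x) xor ⨁ xs (λ x → f x xor g x) ≡⟨ cong ((f x xor g x) xor_) (⨁-xor xs f g) ⟩
    (f x xor g x) xor (⨁ xs f xor ⨁ xs g)       ≡⟨ xor-assoc (f x) (g x) _ ⟩
    f x xor (g x xor (⨁ xs f xor ⨁ xs g))       ≡⟨ cong (f x xor_) (sym (xor-assoc (g x) _ _)) ⟩
    f x xor ((g x xor ⨁ xs f) xor ⨁ xs g)       ≡⟨ cong (λ y → f x xor (y xor ⨁ xs g)) (xor-comm (g x) _) ⟩
    f x xor ((⨁ xs f xor g x) xor ⨁ xs g)       ≡⟨ cong (f x xor_) (xor-assoc (⨁ xs f) _ _) ⟩
    f x xor (⨁ xs f xor (g x xor ⨁ xs g))       ≡⟨ sym (xor-assoc (f x) _ _) ⟩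
    (f x xor ⨁ xs f) xor (g x xor ⨁ xs g)       ∎
    where open ≡-Reasoning

  ⨁-∧ˡ : ∀ xs c (f : A → Bool) → ⨁ xs (λ x → c ∧ f x) ≡ c ∧ ⨁ xs f
  ⨁-∧ˡ [] c f = sym (∧-zeroʳ c)
  ⨁-∧ˡ (x ∷ xs) c f = trans (cong ((c ∧ f x) xor_) (⨁-∧ˡ xs c f)) (sym (∧-distribˡ-xor c (f x) _))

  ⨁-++ : ∀ xs ys (f : A → Bool) → ⨁ (xs ++ ys) f ≡ ⨁ xs f xor ⨁ ys f
  ⨁-++ [] ys f = refl
  ⨁-++ (x ∷ xs) ys f = trans (cong (f x xor_) (⨁-++ xs ys f)) (sym (xor-assoc (f x) _ _))

module _ {A B : Set} where

  ⨁-swap : ∀ (xs : List A) (ys : List B) (F : A → B → Bool) →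
           ⨁ xs (λ x → ⨁ ys (F x)) ≡ ⨁ ys (λ y → ⨁ xs (λ x → F x y))
  ⨁-swap [] ys F = sym (⨁-false ys)
  ⨁-swap (x ∷ xs) ys F = trans (cong (⨁ ys (F x) xor_) (⨁-swap xs ys F))
                                (sym (⨁-xor ys (F x) (λ y → ⨁ xs (λ x → F x y))))

module _ {A : Set} (_≟_ : DecidableEquality A) where

  ⨁-indicator-∉ : ∀ {x xs} → x ∉ xs → ⨁ xs (λ y → does (y ≟ x)) ≡ false
  ⨁-indicator-∉ {x} {[]} x∉xs = refl
  ⨁-indicator-∉ {x} {y ∷ xs} x∉xs =
    cong₂ _xor_ (dec-false (y ≟ x) (λ y≡x → x∉xs (here (sym y≡x)))) (⨁-indicator-∉ (x∉xs ∘ there))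

  ⨁-indicator-∈ : ∀ {x xs} → Unique xs → x ∈ xs → ⨁ xs (λ y → does (y ≟ x)) ≡ true
  ⨁-indicator-∈ {x} (x≢xs ∷ _) (here refl) =
    cong₂ _xor_ (dec-true (x ≟ x) refl) (⨁-indicator-∉ (λ x∈xs → All.lookup x≢xs x∈xs refl))
  ⨁-indicator-∈ {x} {y ∷ xs} (y≢xs ∷ u) (there x∈xs) =
    cong₂ _xor_ (dec-false (y ≟ x) (All.lookup y≢xs x∈xs)) (⨁-indicator-∈ u x∈xs)

  ⨁-sift : ∀ {x xs} (f : A → Bool) → Unique xs → (f x ≡ true → x ∈ xs) →
           ⨁ xs (λ y → does (y ≟ x) ∧ f y) ≡ f x
  ⨁-sift {x} {xs} f u fx⇒x∈xs = begin
    ⨁ xs (λ y → does (y ≟ x) ∧ f y) ≡⟨ ⨁-cong xs (λ {y} _ → indicator-∧ y) ⟩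
    ⨁ xs (λ y → f x ∧ does (y ≟ x)) ≡⟨ ⨁-∧ˡ xs (f x) _ ⟩
    f x ∧ ⨁ xs (λ y → does (y ≟ x)) ≡⟨ count (f x) refl ⟩
    f x                             ∎
    where
    open ≡-Reasoning
    indicator-∧ : ∀ y → does (y ≟ x) ∧ f y ≡ f x ∧ does (y ≟ x)
    indicator-∧ y with y ≟ x
    ... | yes refl = ∧-comm true (f y)
    ... | no _ = sym (∧-zeroʳ (f x))
    count : ∀ c → f x ≡ c → c ∧ ⨁ xs (λ y → does (y ≟ x)) ≡ c
    count false _ = refl
    count true fx = ⨁-indicator-∈ u (fx⇒x∈xs fx)

module _ {A B : Set} (_≟ᴬ_ : DecidableEquality A) (_≟ᴮ_ : DecidableEquality B) where

  ⨁-reindex : ∀ {xs ys} (h : A → B) (g : B → Bool) → Unique xs → Unique ys → Injective _≡_ _≡_ h →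
              (∀ {k} → k ∈ xs → g (h k) ≡ true → h k ∈ ys) →
              (∀ {y} → y ∈ ys → g y ≡ true → ∃ λ k → k ∈ xs × h k ≡ y) →
              ⨁ xs (g ∘ h) ≡ ⨁ ys g
  ⨁-reindex {xs} {ys} h g uxs uys h-inj into onto = begin
    ⨁ xs (g ∘ h)                                          ≡⟨ ⨁-cong xs (λ k∈xs → sym (⨁-sift _≟ᴮ_ g uys (into k∈xs))) ⟩
    ⨁ xs (λ k → ⨁ ys (λ y → does (y ≟ᴮ h k) ∧ g y))       ≡⟨ ⨁-swap xs ys _ ⟩
    ⨁ ys (λ y → ⨁ xs (λ k → does (y ≟ᴮ h k) ∧ g y))       ≡⟨ ⨁-cong ys (λ {y} _ → ⨁-cong xs (λ _ → ∧-comm _ (g y))) ⟩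
    ⨁ ys (λ y → ⨁ xs (λ k → g y ∧ does (y ≟ᴮ h k)))       ≡⟨ ⨁-cong ys (λ {y} _ → ⨁-∧ˡ xs (g y) _) ⟩
    ⨁ ys (λ y → g y ∧ ⨁ xs (λ k → does (y ≟ᴮ h k)))       ≡⟨ ⨁-cong ys (λ y∈ys → preimages y∈ys _ refl) ⟩
    ⨁ ys g                                                ∎
    where
    open ≡-Reasoning
    preimages : ∀ {y} → y ∈ ys → ∀ c → g y ≡ c → c ∧ ⨁ xs (λ k → does (y ≟ᴮ h k)) ≡ c
    preimages y∈ys false _ = refl
    preimages {y} y∈ys true gy with onto y∈ys gy
    ... | k₀ , k₀∈xs , refl = trans (⨁-cong xs same) (⨁-indicator-∈ _≟ᴬ_ uxs k₀∈xs)
      where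
      same : ∀ {k} → k ∈ xs → does (h k₀ ≟ᴮ h k) ≡ does (k ≟ᴬ k₀)
      same {k} _ with h k₀ ≟ᴮ h k | k ≟ᴬ k₀
      ... | yes _ | yes _ = refl
      ... | no _ | no _ = refl
      ... | yes hk₀≡hk | no k≢k₀ = ⊥-elim (k≢k₀ (h-inj (sym hk₀≡hk)))
      ... | no hk₀≢hk | yes refl = ⊥-elim (hk₀≢hk refl)

module _ {A : Set} (_≟_ : DecidableEquality A) where

  ⨁-sameSet : ∀ {xs ys : List A} (f : A → Bool) → Unique xs → Unique ys →
              (∀ {x} → x ∈ xs → x ∈ ys) → (∀ {y} → y ∈ ys → y ∈ xs) → ⨁ xs f ≡ ⨁ ys f
  ⨁-sameSet f uxs uys xs⊆ys ys⊆xs =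
    ⨁-reindex _≟_ _≟_ id f uxs uys id (λ x∈xs _ → xs⊆ys x∈xs) (λ {y} y∈ys _ → y , ys⊆xs y∈ys , refl)

interval : ℤ → ℕ → List ℤ
interval m zero = []
interval m (suc n) = m ∷ interval (ℤ.suc m) n

suc[m]+n≡m+suc[n] : ∀ m n → ℤ.suc m + + n ≡ m + + suc n
suc[m]+n≡m+suc[n] m n = trans (solve (+ n) m) (cong (λ k → m + k) (sym (ℤP.pos-+ 1 n)))
  where solve : ∀ n m → 1ℤ + m + n ≡ m + (+ 1 + n)
        solve = solve-∀

∈-interval⁻ : ∀ {y m n} → y ∈ interval m n → m ℤ.≤ y × y ℤ.< m + + n
∈-interval⁻ {m = m} {suc n} (here refl) =
  ℤP.≤-refl , ℤP.suc[i]≤j⇒i<j (subst (ℤ.suc m ℤ.≤_) (suc[m]+n≡m+suc[n] m n) (ℤP.i≤i+j (ℤ.suc m) (+ n)))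
∈-interval⁻ {m = m} {suc n} (there y∈) with ∈-interval⁻ y∈
... | sm≤y , y<sm+n = ℤP.<⇒≤ (ℤP.suc[i]≤j⇒i<j sm≤y) , subst (_ ℤ.<_) (suc[m]+n≡m+suc[n] m n) y<sm+n

∈-interval⁺ : ∀ {y m n} → m ℤ.≤ y → y ℤ.< m + + n → y ∈ interval m n
∈-interval⁺ {y} {m} {zero} m≤y y<m+0 = ⊥-elim (ℤP.<⇒≱ (subst (y ℤ.<_) (ℤP.+-identityʳ m) y<m+0) m≤y)
∈-interval⁺ {y} {m} {suc n} m≤y y<m+n with m ℤ.≟ y
... | yes refl = here refl
... | no m≢y = there (∈-interval⁺ (ℤP.i<j⇒suc[i]≤j (ℤP.≤∧≢⇒< m≤y m≢y)) (subst (y ℤ.<_) (sym (suc[m]+n≡m+suc[n] m n)) y<m+n))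

interval-unique : ∀ m n → Unique (interval m n)
interval-unique m zero = []
interval-unique m (suc n) =
  All.tabulate (λ y∈ → ℤP.<⇒≢ (ℤP.suc[i]≤j⇒i<j (proj₁ (∈-interval⁻ y∈)))) ∷ interval-unique (ℤ.suc m) n

interval-++ : ∀ m p q → interval m (p ℕ.+ q) ≡ interval m p ++ interval (m + + p) q
interval-++ m zero q = cong (λ k → interval k q) (sym (ℤP.+-identityʳ m))
interval-++ m (suc p) q = cong (m ∷_) (trans (interval-++ (ℤ.suc m) p q) (cong (λ k → interval (ℤ.suc m) p ++ interval k q) (suc[m]+n≡m+suc[n] m p)))

⨁-telescope : ∀ (f : ℤ → Bool) m n → ⨁ (interval m n) (λ k → f k xor f (ℤ.suc k)) ≡ f m xor f (m + + n)
⨁-telescope f m zero = sym (trans (cong (f m xor_) (cong f (ℤP.+-identityʳ m))) (xor-same (f m)))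
⨁-telescope f m (suc n) = begin
  (f m xor f (ℤ.suc m)) xor ⨁ (interval (ℤ.suc m) n) _  ≡⟨ cong ((f m xor f (ℤ.suc m)) xor_) (⨁-telescope f (ℤ.suc m) n) ⟩
  (f m xor f (ℤ.suc m)) xor (f (ℤ.suc m) xor f (ℤ.suc m + + n)) ≡⟨ xor-assoc (f m) _ _ ⟩
  f m xor (f (ℤ.suc m) xor (f (ℤ.suc m) xor f (ℤ.suc m + + n))) ≡⟨ cong (f m xor_) (sym (xor-assoc (f (ℤ.suc m)) _ _)) ⟩
  f m xor ((f (ℤ.suc m) xor f (ℤ.suc m)) xor f (ℤ.suc m + + n)) ≡⟨ cong (λ c → f m xor (c xor f (ℤ.suc m + + n))) (xor-same (f (ℤ.suc m))) ⟩
  f m xor f (ℤ.suc m + + n)                                   ≡⟨ cong (λ k → f m xor f k) (suc[m]+n≡m+suc[n] m n) ⟩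
  f m xor f (m + + suc n)                                     ∎
  where open ≡-Reasoning

length-interval : ∀ m n → length (interval m n) ≡ n
length-interval m zero = refl
length-interval m (suc n) = cong suc (length-interval (ℤ.suc m) n)

xor-≢ : ∀ {p q} → p ≢ q → p xor q ≡ true
xor-≢ {true} {true} p≢q = ⊥-elim (p≢q refl)
xor-≢ {true} {false} _ = refl
xor-≢ {false} {true} _ = refl
xor-≢ {false} {false} p≢q = ⊥-elim (p≢q refl)

xor≡true⇒false : ∀ {p q} → p xor q ≡ true → p ≡ false ⊎ q ≡ false
xor≡true⇒false {true} {false} _ = inj₂ refl
xor≡true⇒false {false} _ = inj₁ refl

xor-pair : ∀ {A : Set} (f : A → Bool) {u w p q} → u ≢ w → (u ≡ p ⊎ u ≡ q) → (w ≡ p ⊎ w ≡ q) →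
           f u xor f w ≡ f p xor f q
xor-pair f u≢w (inj₁ refl) (inj₁ refl) = ⊥-elim (u≢w refl)
xor-pair f u≢w (inj₁ refl) (inj₂ refl) = refl
xor-pair f u≢w (inj₂ refl) (inj₁ refl) = xor-comm (f _) (f _)
xor-pair f u≢w (inj₂ refl) (inj₂ refl) = ⊥-elim (u≢w refl)

isOdd-+ : ∀ m n → isOdd (m ℕ.+ n) ≡ isOdd m xor isOdd n
isOdd-+ zero n = refl
isOdd-+ (suc m) n = trans (cong not (isOdd-+ m n)) (not-distribˡ-xor (isOdd m) (isOdd n))

isOdd-double : ∀ t → isOdd (t ℕ.+ t) ≡ false
isOdd-double t = trans (isOdd-+ t t) (xor-same (isOdd t))

even-gap⇒even-sum : ∀ {a b} → a ℕ.≤ b → isOdd (b ℕ.∸ a) ≡ false → (a ℕ.+ b) % 2 ≡ 0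
even-gap⇒even-sum {a} {b} a≤b even with even-or-odd (b ℕ.∸ a) | ℕP.m∸n+n≡m a≤b
... | t , inj₁ d≡t+t | d+a≡b = begin
  (a ℕ.+ b) % 2                  ≡⟨ cong (λ n → (a ℕ.+ n) % 2) (trans (sym d+a≡b) (cong (ℕ._+ a) d≡t+t)) ⟩
  (a ℕ.+ (t ℕ.+ t ℕ.+ a)) % 2    ≡⟨ cong (_% 2) (solve a t) ⟩
  (t ℕ.+ a) ℕ.* 2 % 2            ≡⟨ m*n%n≡0 (t ℕ.+ a) 2 ⟩
  0                              ∎
  where
  open ≡-Reasoning
  solve : ∀ a t → a ℕ.+ (t ℕ.+ t ℕ.+ a) ≡ (t ℕ.+ a) ℕ.* 2
  solve = ℕ-Solver.solve-∀
... | t , inj₂ d≡1+t+t | _ = ⊥-elim (true≢false (trans (sym (cong not (isOdd-double t))) (trans (cong isOdd (sym d≡1+t+t)) even)))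

-- The zigzag paths

module Zigzag (α β N : ℤ) where

  α-edge-at β-edge-at : ℤ → Set
  α-edge-at x = ¬ (N ∣ x) × ¬ (N ∣ x - β)
  β-edge-at x = (N ∣ x) ⊎ (N ∣ x - α)

  E : ℤ → ℤ → Set
  E x y = (y ≡ x + α × α-edge-at x) ⊎ (x ≡ y + α × α-edge-at y) ⊎ (y ≡ x + β × β-edge-at x) ⊎ (x ≡ y + β × β-edge-at y)

  E-sym : ∀ {x y} → E x y → E y x
  E-sym (inj₁ p) = inj₂ (inj₁ p)
  E-sym (inj₂ (inj₁ p)) = inj₁ p
  E-sym (inj₂ (inj₂ (inj₁ p))) = inj₂ (inj₂ (inj₂ p))
  E-sym (inj₂ (inj₂ (inj₂ p))) = inj₂ (inj₂ (inj₁ p))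

  E-α⁺ : ∀ {x y} → y ≡ x + α → α-edge-at x → E x y
  E-α⁺ y≡ at = inj₁ (y≡ , at)

  E-α⁻ : ∀ {x y} → y ≡ x - α → α-edge-at y → E x y
  E-α⁻ y≡ at = inj₂ (inj₁ (i≡j-k⇒j≡i+k y≡ , at))

  E-β⁺ : ∀ {x y} → y ≡ x + β → β-edge-at x → E x y
  E-β⁺ y≡ at = inj₂ (inj₂ (inj₁ (y≡ , at)))

  E-β⁻ : ∀ {x y} → y ≡ x - β → β-edge-at y → E x y
  E-β⁻ y≡ at = inj₂ (inj₂ (inj₂ (i≡j-k⇒j≡i+k y≡ , at)))

  E-cases : ∀ {v z} → E v z →
    (z ≡ v + α × α-edge-at v) ⊎ (z ≡ v - α × α-edge-at z) ⊎ (z ≡ v + β × β-edge-at v) ⊎ (z ≡ v - β × β-edge-at z)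
  E-cases (inj₁ up) = inj₁ up
  E-cases (inj₂ (inj₁ (v≡z+α , at))) = inj₂ (inj₁ (i≡j+k⇒j≡i-k v≡z+α , at))
  E-cases (inj₂ (inj₂ (inj₁ up))) = inj₂ (inj₂ (inj₁ up))
  E-cases (inj₂ (inj₂ (inj₂ (v≡z+β , at)))) = inj₂ (inj₂ (inj₂ (i≡j+k⇒j≡i-k v≡z+β , at)))

  private
    up : ∀ x s → x + s - x ≡ s
    up = solve-∀
    down : ∀ x s → x - s - x ≡ - s
    down = solve-∀

  E-step : ∀ {x y} → E x y → y - x ≡ α ⊎ y - x ≡ - α ⊎ y - x ≡ β ⊎ y - x ≡ - β
  E-step {x} e with E-cases e
  ... | inj₁ (refl , _) = inj₁ (up x α)
  ... | inj₂ (inj₁ (refl , _)) = inj₂ (inj₁ (down x α))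
  ... | inj₂ (inj₂ (inj₁ (refl , _))) = inj₂ (inj₂ (inj₁ (up x β)))
  ... | inj₂ (inj₂ (inj₂ (refl , _))) = inj₂ (inj₂ (inj₂ (down x β)))

module Canonical (t : ℤ) (e : ℕ) (q : ℤ) where

  d : ℕ
  d = 2 ℕ.+ e

  A D N B : ℤ
  A = + 2 * t + 1ℤ
  D = + d
  N = + 2 * D
  B = A + D + q * N

  open Zigzag A B N public

  module Hamiltonian (cancel : ∀ c → N ∣ c * A → N ∣ c) (0<A : 0ℤ ℤ.< A) (0<B : 0ℤ ℤ.< B) where

    ∤-residue : ∀ {x} c w → x ≡ c * A + w * N → ¬ N ∣ c → ¬ N ∣ x
    ∤-residue c w refl N∤c N∣x = N∤c (cancel c (∣-combination N∣x (divides w refl) (solve c w A N)))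
      where solve : ∀ c w A N → c * A + w * N - w * N ≡ c * A
            solve = solve-∀

    d<N : d ℕ.< 2 ℕ.* d
    d<N = ℕP.m<m+n d (ℕ.s≤s ℕ.z≤n)

    1+d<N : suc d ℕ.< 2 ℕ.* d
    1+d<N = subst₂ ℕ._<_ (ℕP.+-comm d 1) (cong (d ℕ.+_) (sym (ℕP.+-identityʳ d))) (ℕP.+-monoʳ-< d (ℕ.s≤s (ℕ.s≤s ℕ.z≤n)))

    N∤A : ¬ N ∣ A
    N∤A = ∤-residue 1ℤ 0ℤ (solve A N) (∤-pos {2 ℕ.* d} (ℕ.s≤s ℕ.z≤n) (ℕP.<-trans (ℕ.s≤s (ℕ.s≤s ℕ.z≤n)) d<N))
      where solve : ∀ A N → A ≡ 1ℤ * A + 0ℤ * N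
            solve = solve-∀

    N∤B : ¬ N ∣ B
    N∤B = ∤-residue (1ℤ + D) (q - t) (solve t (+ e) q) (∤-pos {2 ℕ.* d} (ℕ.s≤s ℕ.z≤n) 1+d<N)
      where solve : ∀ t e q → let A = + 2 * t + 1ℤ ; D = + 2 + e ; N = + 2 * D in
                    A + D + q * N ≡ (1ℤ + D) * A + (q - t) * N
            solve = solve-∀

    N∤B-A : ¬ N ∣ B - A
    N∤B-A N∣B-A = ∤-pos {2 ℕ.* d} (ℕ.s≤s ℕ.z≤n) d<N (∣-combination N∣B-A (divides q refl) (solve A D q N))
      where solve : ∀ A D q N → A + D + q * N - A - q * N ≡ D
            solve = solve-∀

    A≢B : A ≢ B
    A≢B A≡B = N∤B-A (divides 0ℤ (trans (cong (_- A) (sym A≡B)) (ℤP.+-inverseʳ A)))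

    module AtVertex (v : ℤ) where
      v-A-B≡v-B-A : v - A - B ≡ v - B - A
      v-A-B≡v-B-A = solve v A B
        where solve : ∀ v A B → v - A - B ≡ v - B - A
              solve = solve-∀
      swap : N ∣ v - A - B → N ∣ v - B - A
      swap = subst (N ∣_) v-A-B≡v-B-A
      swap⁻¹ : N ∣ v - B - A → N ∣ v - A - B
      swap⁻¹ = subst (N ∣_) (sym v-A-B≡v-B-A)
      shift≢ : ∀ {i j} → i ≢ j → v + i ≢ v + j
      shift≢ i≢j = i≢j ∘′ +-cancelˡ v _ _

      neighbours-among : ∀ {u w} →
        (α-edge-at v → v + A ≡ u ⊎ v + A ≡ w) → (α-edge-at (v - A) → v - A ≡ u ⊎ v - A ≡ w) →
        (β-edge-at v → v + B ≡ u ⊎ v + B ≡ w) → (β-edge-at (v - B) → v - B ≡ u ⊎ v - B ≡ w) →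
        ∀ z → E v z → z ≡ u ⊎ z ≡ w
      neighbours-among α⁺ α⁻ β⁺ β⁻ z ez with E-cases ez
      ... | inj₁ (refl , at) = α⁺ at
      ... | inj₂ (inj₁ (refl , at)) = α⁻ at
      ... | inj₂ (inj₂ (inj₁ (refl , at))) = β⁺ at
      ... | inj₂ (inj₂ (inj₂ (refl , at))) = β⁻ at

      neighbourhood : ∃[ u ] ∃[ w ] (u ≢ w × E v u × E v w × (∀ z → E v z → z ≡ u ⊎ z ≡ w))
      neighbourhood with N ∣? v | N ∣? v - A | N ∣? v - B | N ∣? v - A - B
      ... | yes p₀ | yes p₁ | _ | _ = ⊥-elim (N∤A (∣-combination p₀ p₁ (solve v A)))
        where solve : ∀ v A → v - (v - A) ≡ A
              solve = solve-∀
      ... | yes p₀ | no _ | yes p₂ | _ = ⊥-elim (N∤B (∣-combination p₀ p₂ (solve v B)))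
        where solve : ∀ v B → v - (v - B) ≡ B
              solve = solve-∀
      ... | no _ | yes p₁ | yes p₂ | _ = ⊥-elim (N∤B-A (∣-combination p₁ p₂ (solve v A B)))
        where solve : ∀ v A B → v - A - (v - B) ≡ B - A
              solve = solve-∀
      ... | no _ | yes p₁ | no _ | yes p₃ = ⊥-elim (N∤B (∣-combination p₁ p₃ (solve v A B)))
        where solve : ∀ v A B → v - A - (v - A - B) ≡ B
              solve = solve-∀
      ... | no _ | no _ | yes p₂ | yes p₃ = ⊥-elim (N∤A (∣-combination p₂ p₃ (solve v A B)))
        where solve : ∀ v A B → v - B - (v - A - B) ≡ A
              solve = solve-∀
      ... | yes p₀ | no _ | no _ | yes p₃ =
        v + B , v - B , shift≢ (pos≢neg 0<B 0<B) , E-β⁺ refl (inj₁ p₀) , E-β⁻ refl (inj₂ (swap p₃)) ,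
        neighbours-among (λ at → ⊥-elim (proj₁ at p₀)) (λ at → ⊥-elim (proj₂ at p₃)) (λ _ → inj₁ refl) (λ _ → inj₂ refl)
      ... | yes p₀ | no p₁ | no p₂ | no p₃ =
        v - A , v + B , shift≢ (pos≢neg 0<B 0<A ∘′ sym) , E-α⁻ refl (p₁ , p₃) , E-β⁺ refl (inj₁ p₀) ,
        neighbours-among (λ at → ⊥-elim (proj₁ at p₀)) (λ _ → inj₁ refl) (λ _ → inj₂ refl) (λ at → ⊥-elim ([ p₂ , p₃ ∘′ swap⁻¹ ]′ at))
      ... | no p₀ | yes p₁ | no p₂ | no p₃ =
        v + A , v + B , shift≢ A≢B , E-α⁺ refl (p₀ , p₂) , E-β⁺ refl (inj₂ p₁) ,
        neighbours-among (λ _ → inj₁ refl) (λ at → ⊥-elim (proj₁ at p₁)) (λ _ → inj₂ refl) (λ at → ⊥-elim ([ p₂ , p₃ ∘′ swap⁻¹ ]′ at))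
      ... | no p₀ | no p₁ | yes p₂ | no p₃ =
        v - A , v - B , shift≢ (A≢B ∘′ ℤP.neg-injective) , E-α⁻ refl (p₁ , p₃) , E-β⁻ refl (inj₁ p₂) ,
        neighbours-among (λ at → ⊥-elim (proj₂ at p₂)) (λ _ → inj₁ refl) (λ at → ⊥-elim ([ p₀ , p₁ ]′ at)) (λ _ → inj₂ refl)
      ... | no p₀ | no p₁ | no p₂ | yes p₃ =
        v + A , v - B , shift≢ (pos≢neg 0<A 0<B) , E-α⁺ refl (p₀ , p₂) , E-β⁻ refl (inj₂ (swap p₃)) ,
        neighbours-among (λ _ → inj₁ refl) (λ at → ⊥-elim (proj₂ at p₃)) (λ at → ⊥-elim ([ p₀ , p₁ ]′ at)) (λ _ → inj₂ refl)
      ... | no p₀ | no p₁ | no p₂ | no p₃ =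
        v + A , v - A , shift≢ (pos≢neg 0<A 0<A) , E-α⁺ refl (p₀ , p₂) , E-α⁻ refl (p₁ , p₃) ,
        neighbours-among (λ _ → inj₁ refl) (λ _ → inj₂ refl) (λ at → ⊥-elim ([ p₀ , p₁ ]′ at)) (λ at → ⊥-elim ([ p₂ , p₃ ∘′ swap⁻¹ ]′ at))

    twoValent : TwoValent E
    twoValent = AtVertex.neighbourhood

    -- In the coordinates v = X α + Y β, the path through 0 runs down the even rows Y = -2k over
    -- X + Y = 0, …, -e and up the odd rows Y = -2k - 1 over X + Y = -e - 1, …, 1.
    even-row : ℤ → ℕ → ℤ
    even-row k j = (+ 2 * k - + j) * A + (- (+ 2 * k)) * B

    odd-row : ℤ → ℕ → ℤ
    odd-row k i = (+ 2 * k - + e + + i) * A + (- (+ 2 * k) - 1ℤ) * B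

    1+j<N : ∀ {j} → j ℕ.< e → suc j ℕ.< 2 ℕ.* d
    1+j<N j<e = ℕP.<-trans (ℕP.≤-<-trans j<e (ℕP.m<n⇒m<1+n (ℕP.n<1+n e))) d<N

    edge-along-even-row : ∀ k j → j ℕ.< e → E (even-row k (suc j)) (even-row k j)
    edge-along-even-row k j j<e = inj₁ (solve k (+ j) A B , N∤ , N∤-B)
      where
      solve : ∀ k j A B → (+ 2 * k - j) * A + (- (+ 2 * k)) * B ≡ (+ 2 * k - (1ℤ + j)) * A + (- (+ 2 * k)) * B + A
      solve = solve-∀
      residue : ∀ t e q k j → let A = + 2 * t + 1ℤ ; D = + 2 + e ; N = + 2 * D ; B = A + D + q * N in
                (+ 2 * k - (1ℤ + j)) * A + (- (+ 2 * k)) * B ≡ (- (1ℤ + j)) * A + (- k - + 2 * k * q) * N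
      residue = solve-∀
      residue-B : ∀ t e q k j → let A = + 2 * t + 1ℤ ; D = + 2 + e ; N = + 2 * D ; B = A + D + q * N in
                (+ 2 * k - (1ℤ + j)) * A + (- (+ 2 * k)) * B - B ≡ (- (+ 2 + j + D)) * A + (- k - + 2 * k * q - q + t) * N
      residue-B = solve-∀
      N∤ : ¬ N ∣ even-row k (suc j)
      N∤ = ∤-residue (- (1ℤ + + j)) (- k - + 2 * k * q) (residue t (+ e) q k (+ j)) (∤-neg {2 ℕ.* d} (ℕ.s≤s ℕ.z≤n) (1+j<N j<e))
      N∤-B : ¬ N ∣ even-row k (suc j) - B
      N∤-B = ∤-residue (- (+ 2 + + j + D)) (- k - + 2 * k * q - q + t) (residue-B t (+ e) q k (+ j)) (∤-neg {2 ℕ.* d} (ℕ.s≤s ℕ.z≤n) bound)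
        where
        bound : 2 ℕ.+ j ℕ.+ d ℕ.< 2 ℕ.* d
        bound = subst (2 ℕ.+ j ℕ.+ d ℕ.<_) (cong (d ℕ.+_) (sym (ℕP.+-identityʳ d))) (ℕP.+-monoˡ-< d (ℕ.s≤s (ℕ.s≤s j<e)))

    edge-into-odd-row : ∀ k → E (odd-row k 0) (even-row k e)
    edge-into-odd-row k = inj₂ (inj₂ (inj₁ (solve k (+ e) A B , inj₂ (divides (- (t + 1ℤ) - k - (+ 2 * k + 1ℤ) * q) (residue t (+ e) q k)))))
      where
      solve : ∀ k e A B → (+ 2 * k - e) * A + (- (+ 2 * k)) * B ≡ (+ 2 * k - e + + 0) * A + (- (+ 2 * k) - 1ℤ) * B + B
      solve = solve-∀
      residue : ∀ t e q k → let A = + 2 * t + 1ℤ ; D = + 2 + e ; N = + 2 * D ; B = A + D + q * N in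
                (+ 2 * k - e + + 0) * A + (- (+ 2 * k) - 1ℤ) * B - A ≡ (- (t + 1ℤ) - k - (+ 2 * k + 1ℤ) * q) * N
      residue = solve-∀

    edge-along-odd-row : ∀ k i → i ℕ.≤ suc e → E (odd-row k i) (odd-row k (suc i))
    edge-along-odd-row k i i≤1+e = inj₁ (solve k (+ e) (+ i) A B , N∤ , N∤-B)
      where
      solve : ∀ k e i A B → (+ 2 * k - e + (1ℤ + i)) * A + (- (+ 2 * k) - 1ℤ) * B ≡ (+ 2 * k - e + i) * A + (- (+ 2 * k) - 1ℤ) * B + A
      solve = solve-∀
      residue : ∀ t e q k i → let A = + 2 * t + 1ℤ ; D = + 2 + e ; N = + 2 * D ; B = A + D + q * N in
                (+ 2 * k - e + i) * A + (- (+ 2 * k) - 1ℤ) * B ≡ (1ℤ + i) * A + (- A - k - (+ 2 * k + 1ℤ) * q + t) * N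
      residue = solve-∀
      residue-B : ∀ t e q k i → let A = + 2 * t + 1ℤ ; D = + 2 + e ; N = + 2 * D ; B = A + D + q * N in
                (+ 2 * k - e + i) * A + (- (+ 2 * k) - 1ℤ) * B - B ≡ (i + D) * A + (- A - A - k - (+ 2 * k + 1ℤ) * q - q + t + t) * N
      residue-B = solve-∀
      N∤ : ¬ N ∣ odd-row k i
      N∤ = ∤-residue (1ℤ + + i) (- A - k - (+ 2 * k + 1ℤ) * q + t) (residue t (+ e) q k (+ i))
             (∤-pos {2 ℕ.* d} (ℕ.s≤s ℕ.z≤n) (ℕP.≤-<-trans (ℕ.s≤s i≤1+e) d<N))
      N∤-B : ¬ N ∣ odd-row k i - B
      N∤-B = ∤-residue (+ i + D) (- A - A - k - (+ 2 * k + 1ℤ) * q - q + t + t) (residue-B t (+ e) q k (+ i))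
               (∤-pos {2 ℕ.* d} (ℕP.<-≤-trans (ℕ.s≤s ℕ.z≤n) (ℕP.m≤n+m d i)) bound)
        where
        bound : i ℕ.+ d ℕ.< 2 ℕ.* d
        bound = subst (i ℕ.+ d ℕ.<_) (cong (d ℕ.+_) (sym (ℕP.+-identityʳ d))) (ℕP.+-monoˡ-< d (ℕ.s≤s i≤1+e))

    edge-into-even-row : ∀ k → E (even-row (ℤ.suc k) 0) (odd-row k (2 ℕ.+ e))
    edge-into-even-row k = inj₂ (inj₂ (inj₁ (solve k (+ e) A B , inj₁ (divides (- (1ℤ + k) - + 2 * (1ℤ + k) * q) (residue t (+ e) q k)))))
      where
      solve : ∀ k e A B → (+ 2 * k - e + (+ 2 + e)) * A + (- (+ 2 * k) - 1ℤ) * B ≡ (+ 2 * (1ℤ + k) - + 0) * A + (- (+ 2 * (1ℤ + k))) * B + B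
      solve = solve-∀
      residue : ∀ t e q k → let A = + 2 * t + 1ℤ ; D = + 2 + e ; N = + 2 * D ; B = A + D + q * N in
                (+ 2 * (1ℤ + k) - + 0) * A + (- (+ 2 * (1ℤ + k))) * B ≡ (- (1ℤ + k) - + 2 * (1ℤ + k) * q) * N
      residue = solve-∀

    walk-along-even-row : ∀ k j → j ℕ.≤ e → Star E (even-row k 0) (even-row k j)
    walk-along-even-row k zero _ = ε
    walk-along-even-row k (suc j) j<e = walk-along-even-row k j (ℕP.<⇒≤ j<e) ◅◅ (E-sym (edge-along-even-row k j j<e) ◅ ε)

    walk-along-odd-row : ∀ k i → i ℕ.≤ 2 ℕ.+ e → Star E (even-row k 0) (odd-row k i)
    walk-along-odd-row k zero _ = walk-along-even-row k e ℕP.≤-refl ◅◅ (E-sym (edge-into-odd-row k) ◅ ε)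
    walk-along-odd-row k (suc i) i<2+e = walk-along-odd-row k i (ℕP.<⇒≤ i<2+e) ◅◅ (edge-along-odd-row k i (ℕP.≤-pred i<2+e) ◅ ε)

    walk-period : ∀ k → Star E (even-row k 0) (even-row (ℤ.suc k) 0)
    walk-period k = walk-along-odd-row k (2 ℕ.+ e) ℕP.≤-refl ◅◅ (E-sym (edge-into-even-row k) ◅ ε)

    walk-from-origin : ∀ k → Star E (even-row 0ℤ 0) (even-row k 0)
    walk-from-origin = ℤ-induction (λ k → Star E (even-row 0ℤ 0) (even-row k 0)) 0ℤ ε
      (λ k w → w ◅◅ walk-period k)
      (λ k w → w ◅◅ reverse E-sym (subst (λ j → Star E (even-row (ℤ.pred k) 0) (even-row j 0)) (ℤP.suc-pred k) (walk-period (ℤ.pred k))))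

    OnZigzag : ℤ → Set
    OnZigzag v = ∃[ k ] ((∃[ j ] j ℕ.≤ e × v ≡ even-row k j) ⊎ (∃[ i ] i ℕ.≤ 2 ℕ.+ e × v ≡ odd-row k i))

    reach : ∀ {v} → OnZigzag v → Star E (even-row 0ℤ 0) v
    reach (k , inj₁ (j , j≤e , refl)) = walk-from-origin k ◅◅ walk-along-even-row k j j≤e
    reach (k , inj₂ (i , i≤2+e , refl)) = walk-from-origin k ◅◅ walk-along-odd-row k i i≤2+e

    on-even-row : ∀ X Y k j → X + Y ≡ - + j → Y ≡ - (+ 2 * k) → X * A + Y * B ≡ even-row k j
    on-even-row X Y k j S≡ Y≡ = trans (split X Y A B) (trans (cong₂ (λ S Y → (S - Y) * A + Y * B) S≡ Y≡) (solve k (+ j) A B))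
      where
      split : ∀ X Y A B → X * A + Y * B ≡ (X + Y - Y) * A + Y * B
      split = solve-∀
      solve : ∀ k j A B → (- j - - (+ 2 * k)) * A + (- (+ 2 * k)) * B ≡ (+ 2 * k - j) * A + (- (+ 2 * k)) * B
      solve = solve-∀

    on-odd-row : ∀ X Y k i → X + Y ≡ + i - + e - 1ℤ → Y ≡ - (+ 2 * k) - 1ℤ → X * A + Y * B ≡ odd-row k i
    on-odd-row X Y k i S≡ Y≡ = trans (split X Y A B) (trans (cong₂ (λ S Y → (S - Y) * A + Y * B) S≡ Y≡) (solve k (+ e) (+ i) A B))
      where
      split : ∀ X Y A B → X * A + Y * B ≡ (X + Y - Y) * A + Y * B
      split = solve-∀
      solve : ∀ k e i A B → (i - e - 1ℤ - (- (+ 2 * k) - 1ℤ)) * A + (- (+ 2 * k) - 1ℤ) * B ≡ (+ 2 * k - e + i) * A + (- (+ 2 * k) - 1ℤ) * B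
      solve = solve-∀

    -- Every integer is X α + Y β (Bézout); adding T copies of a relation s₁ α + s₂ β = 0 with s₁ + s₂ = d
    -- and s₂ odd moves X + Y by T d and flips the parity of Y when T is odd, which brings (X, Y) onto a row.
    module Connectivity (bézout : ∀ v → ∃[ X ] ∃[ Y ] v ≡ X * A + Y * B)
                        (s₁ s₂ w : ℤ) (relation : s₁ * A + s₂ * B ≡ 0ℤ) (s₁+s₂≡D : s₁ + s₂ ≡ D) (s₂≡2w+1 : s₂ ≡ + 2 * w + 1ℤ) where

      shift : ∀ X Y T → X * A + Y * B ≡ (X + T * s₁) * A + (Y + T * s₂) * B
      shift X Y T = begin
        X * A + Y * B                                                ≡⟨ solve X Y T s₁ s₂ A B ⟩
        (X + T * s₁) * A + (Y + T * s₂) * B - T * (s₁ * A + s₂ * B)  ≡⟨ cong (λ z → (X + T * s₁) * A + (Y + T * s₂) * B - T * z) relation ⟩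
        (X + T * s₁) * A + (Y + T * s₂) * B - T * 0ℤ                 ≡⟨ solve₀ ((X + T * s₁) * A) ((Y + T * s₂) * B) T ⟩
        (X + T * s₁) * A + (Y + T * s₂) * B                          ∎
        where
        open ≡-Reasoning
        solve : ∀ X Y T s₁ s₂ A B → X * A + Y * B ≡ (X + T * s₁) * A + (Y + T * s₂) * B - T * (s₁ * A + s₂ * B)
        solve = solve-∀
        solve₀ : ∀ P Q T → P + Q - T * 0ℤ ≡ P + Q
        solve₀ = solve-∀

      shift-sum : ∀ X Y T → X + T * s₁ + (Y + T * s₂) ≡ X + Y + T * D
      shift-sum X Y T = trans (solve X Y T s₁ s₂) (cong (λ z → X + Y + T * z) s₁+s₂≡D)
        where solve : ∀ X Y T s₁ s₂ → X + T * s₁ + (Y + T * s₂) ≡ X + Y + T * (s₁ + s₂)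
              solve = solve-∀

      shift-Y : ∀ Y T → Y + T * s₂ ≡ Y + T * (+ 2 * w + 1ℤ)
      shift-Y Y T = cong (λ z → Y + T * z) s₂≡2w+1

      land-on-even-row : ∀ X Y T k j → j ℕ.≤ e → X + Y + T * D ≡ - + j → Y + T * (+ 2 * w + 1ℤ) ≡ - (+ 2 * k) →
                         OnZigzag (X * A + Y * B)
      land-on-even-row X Y T k j j≤e S≡ Y≡ =
        k , inj₁ (j , j≤e , trans (shift X Y T) (on-even-row (X + T * s₁) (Y + T * s₂) k j (trans (shift-sum X Y T) S≡) (trans (shift-Y Y T) Y≡)))

      land-on-odd-row : ∀ X Y T k i → i ℕ.≤ 2 ℕ.+ e → X + Y + T * D ≡ + i - + e - 1ℤ → Y + T * (+ 2 * w + 1ℤ) ≡ - (+ 2 * k) - 1ℤ →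
                        OnZigzag (X * A + Y * B)
      land-on-odd-row X Y T k i i≤2+e S≡ Y≡ =
        k , inj₂ (i , i≤2+e , trans (shift X Y T) (on-odd-row (X + T * s₁) (Y + T * s₂) k i (trans (shift-sum X Y T) S≡) (trans (shift-Y Y T) Y≡)))

      from-even-Y : ∀ X Y u r Q → Y ≡ + 2 * u → X + Y ≡ - (+ r + Q * N) → r ℕ.< 2 ℕ.* d → OnZigzag (X * A + Y * B)
      from-even-Y X Y u r Q Y≡ S≡ r<N with r ℕ.≤? e
      ... | yes r≤e = land-on-even-row X Y (+ 2 * Q) (- (u + Q * (+ 2 * w + 1ℤ))) r r≤e
                        (trans (cong (λ S → S + + 2 * Q * D) S≡) (solve-S (+ r) Q D))
                        (trans (cong (λ Y → Y + + 2 * Q * (+ 2 * w + 1ℤ)) Y≡) (solve-Y u Q w))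
        where
        solve-S : ∀ r Q D → - (r + Q * (+ 2 * D)) + + 2 * Q * D ≡ - r
        solve-S = solve-∀
        solve-Y : ∀ u Q w → + 2 * u + + 2 * Q * (+ 2 * w + 1ℤ) ≡ - (+ 2 * - (u + Q * (+ 2 * w + 1ℤ)))
        solve-Y = solve-∀
      ... | no r≰e with ℕP.m≤n⇒∃[o]m+o≡n (ℕP.≰⇒> r≰e)
      ...   | s , 1+e+s≡r with ℕP.m≤n⇒∃[o]m+o≡n (s≤2+e)
        where
        s≤2+e : s ℕ.≤ 2 ℕ.+ e
        s≤2+e = ℕP.≤-pred (ℕP.+-cancelˡ-< (suc e) s (3 ℕ.+ e) (subst₂ ℕ._<_ (sym 1+e+s≡r) (ℕ-solve e) r<N))
          where ℕ-solve : ∀ e → 2 ℕ.* (2 ℕ.+ e) ≡ suc e ℕ.+ (3 ℕ.+ e)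
                ℕ-solve = ℕ-Solver.solve-∀
      ...     | i , s+i≡2+e = land-on-odd-row X Y (+ 2 * Q + 1ℤ) (- (u + Q * (+ 2 * w + 1ℤ) + w) - 1ℤ) i
                                (subst (i ℕ.≤_) s+i≡2+e (ℕP.m≤n+m i s)) S-eq (trans (cong (λ Y → Y + (+ 2 * Q + 1ℤ) * (+ 2 * w + 1ℤ)) Y≡) (solve-Y u Q w))
        where
        open ≡-Reasoning
        solve-S : ∀ e s Q → - (1ℤ + e + s + Q * (+ 2 * (+ 2 + e))) + (+ 2 * Q + 1ℤ) * (+ 2 + e) ≡ + 2 + e - s - e - 1ℤ
        solve-S = solve-∀
        solve-Y : ∀ u Q w → + 2 * u + (+ 2 * Q + 1ℤ) * (+ 2 * w + 1ℤ) ≡ - (+ 2 * (- (u + Q * (+ 2 * w + 1ℤ) + w) - 1ℤ)) - 1ℤ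
        solve-Y = solve-∀
        i≡ : + i ≡ + 2 + + e - + s
        i≡ = trans (solve (+ s) (+ i)) (cong (λ z → z - + s) (cong +_ s+i≡2+e))
          where solve : ∀ s i → i ≡ s + i - s
                solve = solve-∀
        S-eq : X + Y + (+ 2 * Q + 1ℤ) * D ≡ + i - + e - 1ℤ
        S-eq = begin
          X + Y + (+ 2 * Q + 1ℤ) * D                        ≡⟨ cong (λ S → S + (+ 2 * Q + 1ℤ) * D) S≡ ⟩
          - (+ r + Q * N) + (+ 2 * Q + 1ℤ) * D              ≡⟨ cong (λ r → - (r + Q * N) + (+ 2 * Q + 1ℤ) * D) (cong +_ (sym 1+e+s≡r)) ⟩
          - (1ℤ + + e + + s + Q * N) + (+ 2 * Q + 1ℤ) * D   ≡⟨ solve-S (+ e) (+ s) Q ⟩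
          + 2 + + e - + s - + e - 1ℤ                        ≡⟨ cong (λ z → z - + e - 1ℤ) (sym i≡) ⟩
          + i - + e - 1ℤ                                    ∎

      from-odd-Y : ∀ X Y u r Q → Y ≡ + 2 * u + 1ℤ → X + Y ≡ 1ℤ - (+ r + Q * N) → r ℕ.< 2 ℕ.* d → OnZigzag (X * A + Y * B)
      from-odd-Y X Y u r Q Y≡ S≡ r<N with r ℕ.≤? 2 ℕ.+ e
      ... | yes r≤2+e with ℕP.m≤n⇒∃[o]m+o≡n r≤2+e
      ...   | i , r+i≡2+e = land-on-odd-row X Y (+ 2 * Q) (- (u + Q * (+ 2 * w + 1ℤ)) - 1ℤ) i
                              (subst (i ℕ.≤_) r+i≡2+e (ℕP.m≤n+m i r)) S-eq
                              (trans (cong (λ Y → Y + + 2 * Q * (+ 2 * w + 1ℤ)) Y≡) (solve-Y u Q w))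
        where
        open ≡-Reasoning
        solve-S : ∀ e i Q → 1ℤ - (+ 2 + e - i + Q * (+ 2 * (+ 2 + e))) + + 2 * Q * (+ 2 + e) ≡ i - e - 1ℤ
        solve-S = solve-∀
        solve-Y : ∀ u Q w → + 2 * u + 1ℤ + + 2 * Q * (+ 2 * w + 1ℤ) ≡ - (+ 2 * (- (u + Q * (+ 2 * w + 1ℤ)) - 1ℤ)) - 1ℤ
        solve-Y = solve-∀
        r≡ : + r ≡ + 2 + + e - + i
        r≡ = trans (solve (+ r) (+ i)) (cong (λ z → z - + i) (cong +_ r+i≡2+e))
          where solve : ∀ r i → r ≡ r + i - i
                solve = solve-∀
        S-eq : X + Y + + 2 * Q * D ≡ + i - + e - 1ℤ
        S-eq = begin
          X + Y + + 2 * Q * D                          ≡⟨ cong (λ S → S + + 2 * Q * D) S≡ ⟩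
          1ℤ - (+ r + Q * N) + + 2 * Q * D             ≡⟨ cong (λ r → 1ℤ - (r + Q * N) + + 2 * Q * D) r≡ ⟩
          1ℤ - (+ 2 + + e - + i + Q * N) + + 2 * Q * D ≡⟨ solve-S (+ e) (+ i) Q ⟩
          + i - + e - 1ℤ                               ∎
      from-odd-Y X Y u r Q Y≡ S≡ r<N | no r≰2+e with ℕP.m≤n⇒∃[o]m+o≡n (ℕP.≰⇒> r≰2+e)
      ...   | j , 3+e+j≡r = land-on-even-row X Y (+ 2 * Q + 1ℤ) (- (u + 1ℤ + Q * (+ 2 * w + 1ℤ) + w)) j j≤e
                              (trans (cong (λ S → S + (+ 2 * Q + 1ℤ) * D) S≡)
                                     (trans (cong (λ r → 1ℤ - (r + Q * N) + (+ 2 * Q + 1ℤ) * D) (cong +_ (sym 3+e+j≡r))) (solve-S (+ e) (+ j) Q)))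
                              (trans (cong (λ Y → Y + (+ 2 * Q + 1ℤ) * (+ 2 * w + 1ℤ)) Y≡) (solve-Y u Q w))
        where
        solve-S : ∀ e j Q → 1ℤ - (+ 3 + e + j + Q * (+ 2 * (+ 2 + e))) + (+ 2 * Q + 1ℤ) * (+ 2 + e) ≡ - j
        solve-S = solve-∀
        solve-Y : ∀ u Q w → + 2 * u + 1ℤ + (+ 2 * Q + 1ℤ) * (+ 2 * w + 1ℤ) ≡ - (+ 2 * - (u + 1ℤ + Q * (+ 2 * w + 1ℤ) + w))
        solve-Y = solve-∀
        j≤e : j ℕ.≤ e
        j≤e = ℕP.≤-pred (ℕP.+-cancelˡ-< (3 ℕ.+ e) j (suc e) (subst₂ ℕ._<_ (sym 3+e+j≡r) (ℕ-solve e) r<N))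
          where ℕ-solve : ∀ e → 2 ℕ.* (2 ℕ.+ e) ≡ 3 ℕ.+ e ℕ.+ suc e
                ℕ-solve = ℕ-Solver.solve-∀

      on-zigzag : ∀ v → OnZigzag v
      on-zigzag v with bézout v
      ... | X , Y , refl with ℤ-even-or-odd Y
      ...   | u , inj₁ Y≡ = from-even-Y X Y u (m %ℕ (2 ℕ.* d)) (m /ℕ (2 ℕ.* d)) Y≡
                              (trans (sym (ℤP.neg-involutive (X + Y))) (cong -_ (a≡a%ℕn+[a/ℕn]*n m (2 ℕ.* d)))) (n%ℕd<d m (2 ℕ.* d))
        where
        m : ℤ
        m = - (X + Y)
      ...   | u , inj₂ Y≡ = from-odd-Y X Y u (m %ℕ (2 ℕ.* d)) (m /ℕ (2 ℕ.* d)) Y≡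
                              (trans (solve (X + Y)) (cong (λ z → 1ℤ - z) (a≡a%ℕn+[a/ℕn]*n m (2 ℕ.* d)))) (n%ℕd<d m (2 ℕ.* d))
        where
        m : ℤ
        m = 1ℤ - (X + Y)
        solve : ∀ S → S ≡ 1ℤ - (1ℤ - S)
        solve = solve-∀

      connected : Connected E
      connected x y = reverse E-sym (reach (on-zigzag x)) ◅◅ reach (on-zigzag y)

zigzag-hamiltonian : ∀ {α β} t e q → let N = + (2 ℕ.* (2 ℕ.+ e)) in
  α ≡ + 2 * t + 1ℤ → β ≡ α + + (2 ℕ.+ e) + q * N → 0ℤ ℤ.< α → 0ℤ ℤ.< β →
  (∀ c → N ∣ c * α → N ∣ c) → (∀ v → ∃[ X ] ∃[ Y ] v ≡ X * α + Y * β) →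
  ∀ s₁ s₂ w → s₁ * α + s₂ * β ≡ 0ℤ → s₁ + s₂ ≡ + (2 ℕ.+ e) → s₂ ≡ + 2 * w + 1ℤ →
  TwoValent (Zigzag.E α β N) × Connected (Zigzag.E α β N)
zigzag-hamiltonian t e q refl refl 0<α 0<β cancel bézout s₁ s₂ w relation sum odd = H.twoValent , C.connected
  where
  module H = Canonical.Hamiltonian t e q cancel 0<α 0<β
  module C = H.Connectivity bézout s₁ s₂ w relation sum odd

Odd : ℕ → Set
Odd n = ∃[ t ] n ≡ suc (t ℕ.+ t)

odd⇒ℤ : ∀ {n} → Odd n → ∃[ t ] + n ≡ + 2 * t + 1ℤ
odd⇒ℤ (t , refl) = + t , solve (+ t)
  where solve : ∀ t → 1ℤ + (t + t) ≡ + 2 * t + 1ℤ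
        solve = solve-∀

2∣⇒¬odd : ∀ {n} → 2 ℕD.∣ n → ¬ Odd n
2∣⇒¬odd (ℕD.divides k refl) (t , eq) = ℕP.even≢odd k t (trans (ℕP.*-comm 2 k) (trans eq (cong suc (cong (t ℕ.+_) (sym (ℕP.+-identityʳ t))))))

odd%2≢0 : ∀ k → (1 ℕ.+ k ℕ.* 2) % 2 ≢ 0
odd%2≢0 k eq = ℕP.1+n≢0 (trans (sym ([m+kn]%n≡m%n 1 k 2)) eq)

both-odd : ∀ {a b} → gcd a b ≡ 1 → (a ℕ.+ b) % 2 ≡ 0 → Odd a × Odd b
both-odd {a} {b} gcd≡1 a+b-even with even-or-odd a | even-or-odd b
... | t , inj₂ a≡ | s , inj₂ b≡ = (t , a≡) , (s , b≡)
... | t , inj₁ a≡ | s , inj₁ b≡ = ⊥-elim (ℕP.1+n≢0 {0} (cong ℕ.pred (ℕD.∣1⇒≡1 (subst (2 ℕD.∣_) gcd≡1 2∣gcd))))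
  where
  ℕ-solve : ∀ t → t ℕ.+ t ≡ t ℕ.* 2
  ℕ-solve = ℕ-Solver.solve-∀
  2∣gcd : 2 ℕD.∣ gcd a b
  2∣gcd = gcd-greatest (ℕD.divides t (trans a≡ (ℕ-solve t))) (ℕD.divides s (trans b≡ (ℕ-solve s)))
... | t , inj₁ a≡ | s , inj₂ b≡ = ⊥-elim (odd%2≢0 (t ℕ.+ s) (subst (λ n → n % 2 ≡ 0) (trans (cong₂ ℕ._+_ a≡ b≡) (ℕ-solve t s)) a+b-even))
  where ℕ-solve : ∀ t s → t ℕ.+ t ℕ.+ suc (s ℕ.+ s) ≡ 1 ℕ.+ (t ℕ.+ s) ℕ.* 2
        ℕ-solve = ℕ-Solver.solve-∀
... | t , inj₂ a≡ | s , inj₁ b≡ = ⊥-elim (odd%2≢0 (t ℕ.+ s) (subst (λ n → n % 2 ≡ 0) (trans (cong₂ ℕ._+_ a≡ b≡) (ℕ-solve t s)) a+b-even))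
  where ℕ-solve : ∀ t s → suc (t ℕ.+ t) ℕ.+ (s ℕ.+ s) ≡ 1 ℕ.+ (t ℕ.+ s) ℕ.* 2
        ℕ-solve = ℕ-Solver.solve-∀

odd-gap : ∀ {a b} → Odd a → Odd b → a ℕ.< b → ∃[ e ] b ≡ a ℕ.+ (2 ℕ.+ e)
odd-gap {a} {b} (t , refl) (s , refl) a<b with s ℕ.≤? t
... | yes s≤t = ⊥-elim (ℕP.<⇒≱ (ℕP.≤-pred a<b) (ℕP.+-mono-≤ s≤t s≤t))
... | no s≰t with ℕP.m≤n⇒∃[o]m+o≡n (ℕP.≰⇒> s≰t)
...   | f , refl = f ℕ.+ f , ℕ-solve t f
  where ℕ-solve : ∀ t f → suc (suc t ℕ.+ f ℕ.+ (suc t ℕ.+ f)) ≡ suc (t ℕ.+ t) ℕ.+ (2 ℕ.+ (f ℕ.+ f))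
        ℕ-solve = ℕ-Solver.solve-∀

coprime-double : ∀ {x d} → Odd x → (∀ {i} → i ℕD.∣ x → i ℕD.∣ d → i ≡ 1) → ℕC.Coprime (2 ℕ.* d) x
coprime-double {x} {d} x-odd trivial {i} (i∣2d , i∣x) = trivial i∣x (ℕC.coprime-divisor i⊥2 i∣2d)
  where
  i⊥2 : ℕC.Coprime i 2
  i⊥2 {zero} (_ , 0∣2) = ⊥-elim (ℕP.1+n≢0 (ℕD.0∣⇒≡0 0∣2))
  i⊥2 {suc zero} _ = refl
  i⊥2 {suc (suc zero)} (2∣i , _) = ⊥-elim (2∣⇒¬odd (ℕD.∣-trans 2∣i i∣x) x-odd)
  i⊥2 {suc (suc (suc j))} (_ , j∣2) with ℕD.∣⇒≤ j∣2
  ... | ℕ.s≤s (ℕ.s≤s ())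

coprime⇒cancel : ∀ {n x} → ℕC.Coprime n x → ∀ c → + n ∣ c * + x → + n ∣ c
coprime⇒cancel {n} {x} n⊥x c n∣cx = ∣ᵤ⇒∣ (ℤC.coprime-divisor (+ n) (+ x) c n⊥x (∣⇒∣ᵤ (subst (+ n ∣_) (ℤP.*-comm c (+ x)) n∣cx)))

bézout : ∀ {a b} → ℕC.Coprime a b → ∀ v → ∃[ X ] ∃[ Y ] v ≡ X * + a + Y * + b
bézout {a} {b} a⊥b v with ℕC.coprime-Bézout a⊥b
... | GCD.Bézout.+- x y eq = v * + x , - (v * + y) , combine (+ x) (+ a) (+ y) (+ b) (pos-eq eq)
  where
  combine : ∀ x a y b → 1ℤ + y * b ≡ x * a → v ≡ v * x * a + - (v * y) * b
  combine x a y b 1+yb≡xa = trans (solve v y b) (trans (cong (λ z → v * z - v * y * b) 1+yb≡xa) (solve′ v x a y b))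
    where solve : ∀ v y b → v ≡ v * (1ℤ + y * b) - v * y * b
          solve = solve-∀
          solve′ : ∀ v x a y b → v * (x * a) - v * y * b ≡ v * x * a + - (v * y) * b
          solve′ = solve-∀
  pos-eq : 1 ℕ.+ y ℕ.* b ≡ x ℕ.* a → 1ℤ + + y * + b ≡ + x * + a
  pos-eq e = trans (cong (λ z → 1ℤ + z) (sym (ℤP.pos-* y b))) (trans (cong +_ e) (ℤP.pos-* x a))
... | GCD.Bézout.-+ x y eq = - (v * + x) , v * + y , combine (+ x) (+ a) (+ y) (+ b) (pos-eq eq)
  where
  combine : ∀ x a y b → 1ℤ + x * a ≡ y * b → v ≡ - (v * x) * a + v * y * b
  combine x a y b 1+xa≡yb = trans (solve v x a) (trans (cong (λ z → v * z - v * x * a) 1+xa≡yb) (solve′ v x a y b))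
    where solve : ∀ v x a → v ≡ v * (1ℤ + x * a) - v * x * a
          solve = solve-∀
          solve′ : ∀ v x a y b → v * (y * b) - v * x * a ≡ - (v * x) * a + v * y * b
          solve′ = solve-∀
  pos-eq : 1 ℕ.+ x ℕ.* a ≡ y ℕ.* b → 1ℤ + + x * + a ≡ + y * + b
  pos-eq e = trans (cong (λ z → 1ℤ + z) (sym (ℤP.pos-* x a))) (trans (cong +_ e) (ℤP.pos-* y b))

-- Enumerating a connected 2-valent graph on ℤ

module Enumeration (E : ℤ → ℤ → Set) (E-sym : ∀ {x y} → E x y → E y x) (E-irrefl : ∀ {x} → ¬ E x x)
                   (twoValent : TwoValent E) (connected : Connected E) where

  record Traversal (H : ℤ → ℤ) : Set where
    field
      step            : ∀ k → E (H k) (H (ℤ.suc k))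
      neighbours      : ∀ k {z} → E (H k) z → z ≡ H (ℤ.pred k) ⊎ z ≡ H (ℤ.suc k)
      nonBacktracking : ∀ k → H (ℤ.pred k) ≢ H (ℤ.suc k)

  open Traversal

  traversal-unique : ∀ {H H′} → Traversal H → Traversal H′ →
                     ∀ i → H i ≡ H′ i → H (ℤ.suc i) ≡ H′ (ℤ.suc i) → ∀ k → H k ≡ H′ k
  traversal-unique {H} {H′} T T′ i p q k = proj₁ (ℤ-induction Agree i (p , q) forward backward k)
    where
    Agree : ℤ → Set
    Agree j = H j ≡ H′ j × H (ℤ.suc j) ≡ H′ (ℤ.suc j)
    forward : ∀ j → Agree j → Agree (ℤ.suc j)
    forward j (p , q) with neighbours T′ (ℤ.suc j) (subst (λ x → E x _) q (step T (ℤ.suc j)))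
    ... | inj₂ r = q , r
    ... | inj₁ r = ⊥-elim (nonBacktracking T (ℤ.suc j)
                     (trans (cong H (ℤP.pred-suc j)) (trans p (trans (cong H′ (sym (ℤP.pred-suc j))) (sym r)))))
    backward : ∀ j → Agree j → Agree (ℤ.pred j)
    backward j (p , q) with neighbours T′ j (subst (λ x → E x (H (ℤ.pred j))) p
                                   (subst (λ x → E (H x) (H (ℤ.pred j))) (ℤP.suc-pred j) (E-sym (step T (ℤ.pred j)))))
    ... | inj₁ r = r , subst (λ x → H x ≡ H′ x) (sym (ℤP.suc-pred j)) p
    ... | inj₂ r = ⊥-elim (nonBacktracking T j (trans r (sym q)))

  translate : ∀ {H} c → Traversal H → Traversal (λ k → H (c + k))
  translate {H} c T = record
    { step = λ k → subst (λ x → E (H (c + k)) (H x)) (suc-inside c k) (step T (c + k))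
    ; neighbours = λ k ez → Data.Sum.map (λ r → trans r (cong H (pred-inside c k))) (λ r → trans r (cong H (suc-inside c k))) (neighbours T (c + k) ez)
    ; nonBacktracking = λ k → subst₂ (λ x y → H x ≢ H y) (pred-inside c k) (suc-inside c k) (nonBacktracking T (c + k))
    }
    where
    suc-inside : ∀ c k → 1ℤ + (c + k) ≡ c + (1ℤ + k)
    suc-inside = solve-∀
    pred-inside : ∀ c k → -1ℤ + (c + k) ≡ c + (-1ℤ + k)
    pred-inside = solve-∀

  reflect : ∀ {H} → Traversal H → Traversal (λ k → H (- k))
  reflect {H} T = record
    { step = λ k → subst₂ (λ x y → E (H x) (H y)) (ℤP.suc-pred (- k)) (pred-neg k) (E-sym (step T (ℤ.pred (- k))))
    ; neighbours = λ k ez → Data.Sum.swap (Data.Sum.map (λ r → trans r (cong H (pred-neg k))) (λ r → trans r (cong H (suc-neg k))) (neighbours T (- k) ez))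
    ; nonBacktracking = λ k eq → nonBacktracking T (- k) (subst₂ (λ x y → H x ≡ H y) (sym (pred-neg k)) (sym (suc-neg k)) (sym eq))
    }
    where
    pred-neg : ∀ k → -1ℤ + - k ≡ - (1ℤ + k)
    pred-neg = solve-∀
    suc-neg : ∀ k → 1ℤ + - k ≡ - (-1ℤ + k)
    suc-neg = solve-∀

  first second : ℤ → ℤ
  first v = proj₁ (twoValent v)
  second v = proj₁ (proj₂ (twoValent v))

  first≢second : ∀ v → first v ≢ second v
  first≢second v = proj₁ (proj₂ (proj₂ (twoValent v)))

  E-first : ∀ v → E v (first v)
  E-first v = proj₁ (proj₂ (proj₂ (proj₂ (twoValent v))))

  E-second : ∀ v → E v (second v)
  E-second v = proj₁ (proj₂ (proj₂ (proj₂ (proj₂ (twoValent v)))))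

  E-only : ∀ v {z} → E v z → z ≡ first v ⊎ z ≡ second v
  E-only v {z} = proj₂ (proj₂ (proj₂ (proj₂ (proj₂ (twoValent v))))) z

  other : ℤ → ℤ → ℤ
  other v p with p ℤ.≟ first v
  ... | yes _ = second v
  ... | no _ = first v

  other-spec : ∀ {v p} → E v p → E v (other v p) × p ≢ other v p × (∀ {z} → E v z → z ≡ p ⊎ z ≡ other v p)
  other-spec {v} {p} e with p ℤ.≟ first v
  ... | yes refl = E-second v , first≢second v , λ ez → E-only v ez
  ... | no p≢first with E-only v e
  ...   | inj₁ p≡first = ⊥-elim (p≢first p≡first)
  ...   | inj₂ refl = E-first v , (λ eq → first≢second v (sym eq)) , λ ez → Data.Sum.swap (E-only v ez)

  ray : ℤ → ℤ → ℕ → ℤ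
  ray v₀ v₁ zero = v₀
  ray v₀ v₁ (suc n) = ray v₁ (other v₁ v₀) n

  ray-step : ∀ {v₀ v₁} → E v₀ v₁ → ∀ n → E (ray v₀ v₁ n) (ray v₀ v₁ (suc n))
  ray-step e zero = e
  ray-step e (suc n) = ray-step (proj₁ (other-spec (E-sym e))) n

  ray-neighbours : ∀ {v₀ v₁} → E v₀ v₁ → ∀ n {z} → E (ray v₀ v₁ (suc n)) z →
                   z ≡ ray v₀ v₁ n ⊎ z ≡ ray v₀ v₁ (suc (suc n))
  ray-neighbours e zero = proj₂ (proj₂ (other-spec (E-sym e)))
  ray-neighbours e (suc n) = ray-neighbours (proj₁ (other-spec (E-sym e))) n

  ray-nonBacktracking : ∀ {v₀ v₁} → E v₀ v₁ → ∀ n → ray v₀ v₁ n ≢ ray v₀ v₁ (suc (suc n))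
  ray-nonBacktracking e zero = proj₁ (proj₂ (other-spec (E-sym e)))
  ray-nonBacktracking e (suc n) = ray-nonBacktracking (proj₁ (other-spec (E-sym e))) n

  h : ℤ → ℤ
  h (+ n) = ray 0ℤ (first 0ℤ) n
  h -[1+ n ] = ray 0ℤ (second 0ℤ) (suc n)

  h-traversal : Traversal h
  h-traversal = record { step = stp ; neighbours = nbs ; nonBacktracking = nbt }
    where
    stp : ∀ k → E (h k) (h (ℤ.suc k))
    stp (+ n) = ray-step (E-first 0ℤ) n
    stp -[1+ zero ] = E-sym (ray-step (E-second 0ℤ) 0)
    stp -[1+ suc n ] = E-sym (ray-step (E-second 0ℤ) (suc n))
    nbs : ∀ k {z} → E (h k) z → z ≡ h (ℤ.pred k) ⊎ z ≡ h (ℤ.suc k)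
    nbs (+ zero) ez = Data.Sum.swap (E-only 0ℤ ez)
    nbs (+ suc n) ez = ray-neighbours (E-first 0ℤ) n ez
    nbs -[1+ zero ] ez = Data.Sum.swap (ray-neighbours (E-second 0ℤ) 0 ez)
    nbs -[1+ suc n ] ez = Data.Sum.swap (ray-neighbours (E-second 0ℤ) (suc n) ez)
    nbt : ∀ k → h (ℤ.pred k) ≢ h (ℤ.suc k)
    nbt (+ zero) eq = first≢second 0ℤ (sym eq)
    nbt (+ suc n) = ray-nonBacktracking (E-first 0ℤ) n
    nbt -[1+ zero ] eq = ray-nonBacktracking (E-second 0ℤ) 0 (sym eq)
    nbt -[1+ suc n ] eq = ray-nonBacktracking (E-second 0ℤ) (suc n) (sym eq)

  h-surjective : ∀ v → ∃[ k ] h k ≡ v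
  h-surjective v = reach (connected 0ℤ v) (0ℤ , refl)
    where
    reach : ∀ {x y} → Star E x y → ∃[ k ] h k ≡ x → ∃[ k ] h k ≡ y
    reach ε found = found
    reach (e ◅ w) (k , refl) = reach w ([ (λ r → ℤ.pred k , sym r) , (λ r → ℤ.suc k , sym r) ]′ (neighbours h-traversal k e))

  -- A periodic h would take only finitely many values, hence could not be onto.
  aperiodic : ∀ p → ¬ (∀ k → h k ≡ h (+ suc p + k))
  aperiodic p periodic with finite-bound (λ r → h (+ r)) (suc p)
  ... | M , bound with h-surjective (+ suc M)
  ... | k , hk = ℕP.<-irrefl refl (subst (λ v → ∣ v ∣ ℕ.≤ M) (trans (sym (reduce k)) hk) (bound (k %ℕ suc p) (n%ℕd<d k (suc p))))
    where
    P : ℤ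
    P = + suc p
    multiples : ∀ r q → h (r + q * P) ≡ h r
    multiples r = ℤ-induction (λ q → h (r + q * P) ≡ h r) 0ℤ (cong h (lemma₀ r P)) up down
      where
      lemma₀ : ∀ r P → r + 0ℤ * P ≡ r
      lemma₀ = solve-∀
      lemma₁ : ∀ q r P → r + (1ℤ + q) * P ≡ P + (r + q * P)
      lemma₁ = solve-∀
      lemma₂ : ∀ q r P → P + (r + (-1ℤ + q) * P) ≡ r + q * P
      lemma₂ = solve-∀
      up : ∀ q → h (r + q * P) ≡ h r → h (r + ℤ.suc q * P) ≡ h r
      up q hq = trans (cong h (lemma₁ q r P)) (trans (sym (periodic (r + q * P))) hq)
      down : ∀ q → h (r + q * P) ≡ h r → h (r + ℤ.pred q * P) ≡ h r
      down q hq = trans (periodic (r + ℤ.pred q * P)) (trans (cong h (lemma₂ q r P)) hq)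
    reduce : ∀ k → h k ≡ h (+ (k %ℕ suc p))
    reduce k = trans (cong h (a≡a%ℕn+[a/ℕn]*n k (suc p))) (multiples (+ (k %ℕ suc p)) (k /ℕ suc p))

  private
    no-return : ∀ i n → h i ≢ h (i + + suc n)
    no-return i n eq with neighbours h-traversal (i + + suc n) (subst (λ x → E x (h (ℤ.suc i))) eq (step h-traversal i))
    ... | inj₂ r = aperiodic n (traversal-unique h-traversal (translate (+ suc n) h-traversal) i
                      (trans eq (cong h (ℤP.+-comm i (+ suc n)))) (trans r (cong h (lemma i (+ suc n)))))
      where
      lemma : ∀ i d → 1ℤ + (i + d) ≡ d + (1ℤ + i)
      lemma = solve-∀
    ... | inj₁ r with even-or-odd n
    ...   | t , n≡t+t⊎1+t+t = contradiction n≡t+t⊎1+t+t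
      where
      j : ℤ
      j = i + + suc n
      mirror : ∀ k → h k ≡ h (i + j - k)
      mirror = traversal-unique h-traversal (reflect (translate (i + j) h-traversal)) i
                 (trans eq (cong h (lemma₀ i j))) (trans r (cong h (lemma₁ i j)))
        where
        lemma₀ : ∀ i j → j ≡ i + j + - i
        lemma₀ = solve-∀
        lemma₁ : ∀ i j → -1ℤ + j ≡ i + j + - (1ℤ + i)
        lemma₁ = solve-∀
      contradiction : n ≡ t ℕ.+ t ⊎ n ≡ suc (t ℕ.+ t) → ⊥
      contradiction (inj₁ refl) = E-irrefl (subst (E (h (i + + t))) (sym (trans (mirror (i + + t)) (cong h (lemma i (+ t))))) (step h-traversal (i + + t)))
        where
        lemma : ∀ i t → i + (i + (+ 1 + (t + t))) - (i + t) ≡ 1ℤ + (i + t)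
        lemma = solve-∀
      contradiction (inj₂ refl) = nonBacktracking h-traversal (ℤ.suc (i + + t)) (trans (cong h (ℤP.pred-suc (i + + t))) (trans (mirror (i + + t)) (cong h (lemma i (+ t)))))
        where
        lemma : ∀ i t → i + (i + (+ 1 + (+ 1 + (t + t)))) - (i + t) ≡ 1ℤ + (1ℤ + (i + t))
        lemma = solve-∀

  h-injective : ∀ {i j} → h i ≡ h j → i ≡ j
  h-injective {i} {j} eq with j - i in d
  ... | + zero = sym (trans (lemma i j) (trans (cong (λ x → i + x) d) (ℤP.+-identityʳ i)))
    where lemma : ∀ i j → j ≡ i + (j - i)
          lemma = solve-∀
  ... | +[1+ n ] = ⊥-elim (no-return i n (trans eq (cong h (trans (lemma i j) (cong (λ x → i + x) d)))))
    where lemma : ∀ i j → j ≡ i + (j - i)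
          lemma = solve-∀
  ... | -[1+ n ] = ⊥-elim (no-return j n (trans (sym eq) (cong h (trans (lemma i j) (cong (λ x → j - x) d)))))
    where lemma : ∀ i j → i ≡ j - (j - i)
          lemma = solve-∀

-- Crossing between the negative and the non-negative integers

isNeg : ℤ → Bool
isNeg (+ _) = false
isNeg -[1+ _ ] = true

isNeg-< : ∀ {x} → x ℤ.< 0ℤ → isNeg x ≡ true
isNeg-< {+ _} (ℤ.+<+ ())
isNeg-< { -[1+ _ ]} _ = refl

isNeg-≥ : ∀ {x} → 0ℤ ℤ.≤ x → isNeg x ≡ false
isNeg-≥ {+ _} _ = refl
isNeg-≥ { -[1+ _ ]} ()

isNeg-stable : ∀ {b x y} → ∣ y - x ∣ ℕ.≤ b → b ℕ.< ∣ x ∣ → b ℕ.< ∣ y ∣ → isNeg x ≡ isNeg y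
isNeg-stable {x = + _} {+ _} _ _ _ = refl
isNeg-stable {x = -[1+ _ ]} { -[1+ _ ]} _ _ _ = refl
isNeg-stable {b} {+ m} { -[1+ n ]} step b<m _ =
  ⊥-elim (ℕP.<⇒≱ b<m (ℕP.≤-trans (ℕP.m≤n+m m (suc n)) (subst (ℕ._≤ b) (cong ∣_∣ (lemma (+ n) (+ m))) step)))
  where lemma : ∀ n m → - (1ℤ + n) - m ≡ - (1ℤ + n + m)
        lemma = solve-∀
isNeg-stable {b} { -[1+ m ]} {+ n} step _ b<n = ⊥-elim (ℕP.<⇒≱ b<n (ℕP.≤-trans (ℕP.m≤m+n n (suc m)) step))

window : ℕ → List ℤ
window b = interval (- + b) b

∈-window⁻ : ∀ {b y} → y ∈ window b → ∃[ n ] suc n ℕ.≤ b × y ≡ -[1+ n ]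
∈-window⁻ {b} {y} y∈ with ∈-interval⁻ y∈
... | -b≤y , y<0 with y
...   | + _ = ⊥-elim (ℤP.<⇒≱ (subst (_ ℤ.<_) (ℤP.+-inverseˡ (+ b)) y<0) (ℤ.+≤+ ℕ.z≤n))
...   | -[1+ n ] = n , ℤP.drop‿+≤+ (ℤP.neg-cancel-≤ -b≤y) , refl

∈-window⁺ : ∀ {b n} → suc n ℕ.≤ b → -[1+ n ] ∈ window b
∈-window⁺ {b} 1+n≤b = ∈-interval⁺ (ℤP.neg-mono-≤ (ℤ.+≤+ 1+n≤b)) (subst (_ ℤ.<_) (sym (ℤP.+-inverseˡ (+ b))) ℤ.-<+)

window-isNeg : ∀ {b x} → x ∈ window b → isNeg x ≡ true
window-isNeg x∈ with ∈-window⁻ x∈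
... | _ , _ , refl = refl

-- Exactly d of the points -(d + c), …, -1 stay negative after adding c.
⨁-window-shift : ∀ d c → ⨁ (window (d ℕ.+ c)) (λ x → isNeg (x + + c)) ≡ isOdd d
⨁-window-shift d c = begin
  ⨁ (interval m (d ℕ.+ c)) f                         ≡⟨ cong (λ xs → ⨁ xs f) (interval-++ m d c) ⟩
  ⨁ (interval m d ++ interval (m + + d) c) f ≡⟨ ⨁-++ (interval m d) _ f ⟩
  ⨁ (interval m d) f xor ⨁ (interval (m + + d) c) f  ≡⟨ cong₂ _xor_ lower upper ⟩
  isOdd d xor false                                 ≡⟨ xor-identityʳ _ ⟩
  isOdd d                                           ∎
  where
  open ≡-Reasoning
  m : ℤ
  m = - + (d ℕ.+ c)
  f : ℤ → Bool
  f x = isNeg (x + + c)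
  m+d≡-c : m + + d ≡ - + c
  m+d≡-c = trans (cong (λ z → - z + + d) (ℤP.pos-+ d c)) (solve (+ d) (+ c))
    where solve : ∀ d c → - (d + c) + d ≡ - c
          solve = solve-∀
  lower : ⨁ (interval m d) f ≡ isOdd d
  lower = trans (⨁-cong (interval m d) below) (trans (⨁-true (interval m d)) (cong isOdd (length-interval m d)))
    where
    below : ∀ {x} → x ∈ interval m d → f x ≡ true
    below {x} x∈ = isNeg-< (subst (x + + c ℤ.<_) (ℤP.+-inverseˡ (+ c)) (ℤP.+-monoˡ-< (+ c) (subst (x ℤ.<_) m+d≡-c (proj₂ (∈-interval⁻ x∈)))))
  upper : ⨁ (interval (m + + d) c) f ≡ false
  upper = trans (⨁-cong (interval (m + + d) c) above) (⨁-false (interval (m + + d) c))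
    where
    above : ∀ {x} → x ∈ interval (m + + d) c → f x ≡ false
    above {x} x∈ = isNeg-≥ (subst (ℤ._≤ x + + c) (ℤP.+-inverseˡ (+ c)) (ℤP.+-monoˡ-≤ (+ c) (subst (ℤ._≤ x) m+d≡-c (proj₁ (∈-interval⁻ x∈)))))

walk-divisible : ∀ {E : ℤ → ℤ → Set} {g} → (∀ {x y} → E x y → g ∣ (y - x)) → ∀ {x y} → Star E x y → g ∣ (y - x)
walk-divisible dv {x} ε = divides 0ℤ (ℤP.+-inverseʳ x)
walk-divisible {g = g} dv {x} {y} (_◅_ {j = z} e w) = subst (g ∣_) (solve x y z) (∣m∣n⇒∣m+n (walk-divisible dv w) (dv e))
  where solve : ∀ x y z → y - z + (z - x) ≡ y - x
        solve = solve-∀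

-- Hamilton decompositions of Cay(ℤ, {±a, ±b})

module Cayley (a b : ℕ) (0<a : 0 ℕ.< a) (a<b : a ℕ.< b) where

  0<b : 0 ℕ.< b
  0<b = ℕP.<-trans 0<a a<b

  S : ℤ → Set
  S = S₂ a b

  S-bounded : ∀ {z} → S z → ∣ z ∣ ℕ.≤ b
  S-bounded (inj₁ refl) = ℕP.<⇒≤ a<b
  S-bounded (inj₂ (inj₁ refl)) = subst (ℕ._≤ b) (sym (ℤP.∣-i∣≡∣i∣ (+ a))) (ℕP.<⇒≤ a<b)
  S-bounded (inj₂ (inj₂ (inj₁ refl))) = ℕP.≤-refl
  S-bounded (inj₂ (inj₂ (inj₂ refl))) = subst (ℕ._≤ b) (sym (ℤP.∣-i∣≡∣i∣ (+ b))) ℕP.≤-refl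

  S-nonzero : ¬ S 0ℤ
  S-nonzero s = ℕP.<⇒≱ 0<a (ℕP.≤-trans {j = ∣ 0ℤ ∣} (S-lower s) ℕ.z≤n)
    where
    S-lower : ∀ {z} → S z → a ℕ.≤ ∣ z ∣
    S-lower (inj₁ refl) = ℕP.≤-refl
    S-lower (inj₂ (inj₁ refl)) = subst (a ℕ.≤_) (sym (ℤP.∣-i∣≡∣i∣ (+ a))) ℕP.≤-refl
    S-lower (inj₂ (inj₂ (inj₁ refl))) = ℕP.<⇒≤ a<b
    S-lower (inj₂ (inj₂ (inj₂ refl))) = subst (a ℕ.≤_) (sym (ℤP.∣-i∣≡∣i∣ (+ b))) (ℕP.<⇒≤ a<b)

  S-divisible : ∀ {z} → S z → + gcd a b ∣ z
  S-divisible (inj₁ refl) = ∣ᵤ⇒∣ (gcd[m,n]∣m a b)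
  S-divisible (inj₂ (inj₁ refl)) = ∣m⇒∣-m (∣ᵤ⇒∣ (gcd[m,n]∣m a b))
  S-divisible (inj₂ (inj₂ (inj₁ refl))) = ∣ᵤ⇒∣ (gcd[m,n]∣n a b)
  S-divisible (inj₂ (inj₂ (inj₂ refl))) = ∣m⇒∣-m (∣ᵤ⇒∣ (gcd[m,n]∣n a b))

  candidates : ℤ → List ℤ
  candidates x = x + + a ∷ x - + a ∷ x + + b ∷ x - + b ∷ []

  ∈-candidates : ∀ {x y} → S (y - x) → y ∈ candidates x
  ∈-candidates (inj₁ e) = here (i-j≡k⇒i≡j+k e)
  ∈-candidates (inj₂ (inj₁ e)) = there (here (i-j≡k⇒i≡j+k e))
  ∈-candidates (inj₂ (inj₂ (inj₁ e))) = there (there (here (i-j≡k⇒i≡j+k e)))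
  ∈-candidates (inj₂ (inj₂ (inj₂ e))) = there (there (there (here (i-j≡k⇒i≡j+k e))))

  0<+a : 0ℤ ℤ.< + a
  0<+a = ℤ.+<+ 0<a

  0<+b : 0ℤ ℤ.< + b
  0<+b = ℤ.+<+ 0<b

  +a≢+b : + a ≢ + b
  +a≢+b = ℕP.<⇒≢ a<b ∘′ ℤP.+-injective

  candidates-unique : ∀ x → Unique (candidates x)
  candidates-unique x =
      (shift (pos≢neg 0<+a 0<+a) ∷ shift +a≢+b ∷ shift (pos≢neg 0<+a 0<+b) ∷ [])
    ∷ (shift (pos≢neg 0<+b 0<+a ∘′ sym) ∷ shift (+a≢+b ∘′ ℤP.neg-injective) ∷ [])
    ∷ (shift (pos≢neg 0<+b 0<+b) ∷ [])
    ∷ [] ∷ []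
    where
    shift : ∀ {i j} → i ≢ j → x + i ≢ x + j
    shift i≢j = i≢j ∘′ +-cancelˡ x _ _

  module TwoZigzags (e : ℕ) (b≡a+d : b ≡ a ℕ.+ (2 ℕ.+ e)) (a-odd : Odd a) (b-odd : Odd b) (a⊥b : ℕC.Coprime a b) where

    d : ℕ
    d = 2 ℕ.+ e

    N : ℤ
    N = + (2 ℕ.* d)

    +b≡+a+d : + b ≡ + a + + d
    +b≡+a+d = cong +_ b≡a+d

    d⊥a : ∀ {i} → i ℕD.∣ a → i ℕD.∣ d → i ≡ 1
    d⊥a i∣a i∣d = a⊥b (i∣a , subst (_ ℕD.∣_) (sym b≡a+d) (ℕD.∣m∣n⇒∣m+n i∣a i∣d))

    d⊥b : ∀ {i} → i ℕD.∣ b → i ℕD.∣ d → i ≡ 1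
    d⊥b i∣b i∣d = a⊥b (ℕD.∣m+n∣m⇒∣n (subst (_ ℕD.∣_) (trans b≡a+d (ℕP.+-comm a d)) i∣b) i∣d , i∣b)

    module H₁ = Zigzag (+ a) (+ b) N
    module H₂ = Zigzag (+ b) (+ a) N

    hamiltonian₁ : TwoValent H₁.E × Connected H₁.E
    hamiltonian₁ with odd⇒ℤ a-odd
    ... | t , a≡2t+1 =
      zigzag-hamiltonian t e 0ℤ a≡2t+1 (trans +b≡+a+d (sym (ℤP.+-identityʳ _))) 0<+a 0<+b
        (coprime⇒cancel (coprime-double a-odd d⊥a)) (bézout a⊥b) (+ b) (- + a) (- t - 1ℤ)
        (solve₀ (+ a) (+ b)) (trans (cong (_- + a) +b≡+a+d) (solve₁ (+ a) (+ d))) (trans (cong -_ a≡2t+1) (solve₂ t))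
      where
      solve₀ : ∀ a b → b * a + - a * b ≡ 0ℤ
      solve₀ = solve-∀
      solve₁ : ∀ a d → a + d - a ≡ d
      solve₁ = solve-∀
      solve₂ : ∀ t → - (+ 2 * t + 1ℤ) ≡ + 2 * (- t - 1ℤ) + 1ℤ
      solve₂ = solve-∀

    hamiltonian₂ : TwoValent H₂.E × Connected H₂.E
    hamiltonian₂ with odd⇒ℤ b-odd
    ... | s , b≡2s+1 =
      zigzag-hamiltonian s e -1ℤ b≡2s+1 (trans (solve₀ (+ a) (+ d)) (cong₂ (λ x n → x + + d + -1ℤ * n) (sym +b≡+a+d) (sym (ℤP.pos-* 2 d))))
        0<+b 0<+a (coprime⇒cancel (coprime-double b-odd d⊥b)) (bézout (ℕC.sym a⊥b)) (- + a) (+ b) s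
        (solve₁ (+ a) (+ b)) (trans (cong (λ z → - + a + z) +b≡+a+d) (solve₂ (+ a) (+ d))) b≡2s+1
      where
      solve₀ : ∀ a d → a ≡ a + d + d + -1ℤ * (+ 2 * d)
      solve₀ = solve-∀
      solve₁ : ∀ a b → - a * b + b * a ≡ 0ℤ
      solve₁ = solve-∀
      solve₂ : ∀ a d → - a + (a + d) ≡ d
      solve₂ = solve-∀

    adjacent₂ : ∀ {x y} → H₂.E x y → S (y - x)
    adjacent₂ e with H₂.E-step e
    ... | inj₁ p = inj₂ (inj₂ (inj₁ p))
    ... | inj₂ (inj₁ p) = inj₂ (inj₂ (inj₂ p))
    ... | inj₂ (inj₂ (inj₁ p)) = inj₁ p
    ... | inj₂ (inj₂ (inj₂ p)) = inj₂ (inj₁ p)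

    path : Bool → Subgraph (Cay S)
    path true = record { E = H₁.E ; E⊆Adj = H₁.E-step ; E-sym = H₁.E-sym }
    path false = record { E = H₂.E ; E⊆Adj = adjacent₂ ; E-sym = H₂.E-sym }

    -- H₂ takes an edge of a given step exactly where H₁ does not.
    complementary : ∀ {x y} → H₁.E x y → H₂.E x y → ⊥
    complementary {x} e₁ e₂ with H₁.E-cases e₁ | H₂.E-cases e₂
    ... | inj₁ (_ , N∤x , N∤x-b) | inj₂ (inj₂ (inj₁ (_ , N∣x⊎N∣x-b))) = [ N∤x , N∤x-b ]′ N∣x⊎N∣x-b
    ... | inj₂ (inj₁ (_ , N∤y , N∤y-b)) | inj₂ (inj₂ (inj₂ (_ , N∣y⊎N∣y-b))) = [ N∤y , N∤y-b ]′ N∣y⊎N∣y-b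
    ... | inj₂ (inj₂ (inj₁ (_ , N∣x⊎N∣x-a))) | inj₁ (_ , N∤x , N∤x-a) = [ N∤x , N∤x-a ]′ N∣x⊎N∣x-a
    ... | inj₂ (inj₂ (inj₂ (_ , N∣y⊎N∣y-a))) | inj₂ (inj₁ (_ , N∤y , N∤y-a)) = [ N∤y , N∤y-a ]′ N∣y⊎N∣y-a
    ... | inj₁ (p , _) | inj₁ (q , _) = +a≢+b (same-step x p q)
    ... | inj₁ (p , _) | inj₂ (inj₁ (q , _)) = pos≢neg 0<+a 0<+b (same-step x p q)
    ... | inj₁ (p , _) | inj₂ (inj₂ (inj₂ (q , _))) = pos≢neg 0<+a 0<+a (same-step x p q)
    ... | inj₂ (inj₁ (p , _)) | inj₁ (q , _) = pos≢neg 0<+b 0<+a (same-step x q p)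
    ... | inj₂ (inj₁ (p , _)) | inj₂ (inj₁ (q , _)) = +a≢+b (ℤP.neg-injective (same-step x p q))
    ... | inj₂ (inj₁ (p , _)) | inj₂ (inj₂ (inj₁ (q , _))) = pos≢neg 0<+a 0<+a (same-step x q p)
    ... | inj₂ (inj₂ (inj₁ (p , _))) | inj₂ (inj₁ (q , _)) = pos≢neg 0<+b 0<+b (same-step x p q)
    ... | inj₂ (inj₂ (inj₁ (p , _))) | inj₂ (inj₂ (inj₁ (q , _))) = +a≢+b (same-step x q p)
    ... | inj₂ (inj₂ (inj₁ (p , _))) | inj₂ (inj₂ (inj₂ (q , _))) = pos≢neg 0<+b 0<+a (same-step x p q)
    ... | inj₂ (inj₂ (inj₂ (p , _))) | inj₁ (q , _) = pos≢neg 0<+b 0<+b (same-step x q p)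
    ... | inj₂ (inj₂ (inj₂ (p , _))) | inj₂ (inj₂ (inj₁ (q , _))) = pos≢neg 0<+a 0<+b (same-step x q p)
    ... | inj₂ (inj₂ (inj₂ (p , _))) | inj₂ (inj₂ (inj₂ (q , _))) = +a≢+b (ℤP.neg-injective (same-step x q p))

    covers : ∀ x y → Cay S x y → ∃[ i ] Subgraph.E (path i) x y
    covers x y (inj₁ step) with N ∣? x | N ∣? x - + b
    ... | no N∤x | no N∤x-b = true , H₁.E-α⁺ (i-j≡k⇒i≡j+k step) (N∤x , N∤x-b)
    ... | yes N∣x | _ = false , H₂.E-β⁺ (i-j≡k⇒i≡j+k step) (inj₁ N∣x)
    ... | no _ | yes N∣x-b = false , H₂.E-β⁺ (i-j≡k⇒i≡j+k step) (inj₂ N∣x-b)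
    covers x y (inj₂ (inj₁ step)) with N ∣? y | N ∣? y - + b
    ... | no N∤y | no N∤y-b = true , H₁.E-α⁻ (i-j≡k⇒i≡j+k step) (N∤y , N∤y-b)
    ... | yes N∣y | _ = false , H₂.E-β⁻ (i-j≡k⇒i≡j+k step) (inj₁ N∣y)
    ... | no _ | yes N∣y-b = false , H₂.E-β⁻ (i-j≡k⇒i≡j+k step) (inj₂ N∣y-b)
    covers x y (inj₂ (inj₂ (inj₁ step))) with N ∣? x | N ∣? x - + a
    ... | no N∤x | no N∤x-a = false , H₂.E-α⁺ (i-j≡k⇒i≡j+k step) (N∤x , N∤x-a)
    ... | yes N∣x | _ = true , H₁.E-β⁺ (i-j≡k⇒i≡j+k step) (inj₁ N∣x)
    ... | no _ | yes N∣x-a = true , H₁.E-β⁺ (i-j≡k⇒i≡j+k step) (inj₂ N∣x-a)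
    covers x y (inj₂ (inj₂ (inj₂ step))) with N ∣? y | N ∣? y - + a
    ... | no N∤y | no N∤y-a = false , H₂.E-α⁻ (i-j≡k⇒i≡j+k step) (N∤y , N∤y-a)
    ... | yes N∣y | _ = true , H₁.E-β⁻ (i-j≡k⇒i≡j+k step) (inj₁ N∣y)
    ... | no _ | yes N∣y-a = true , H₁.E-β⁻ (i-j≡k⇒i≡j+k step) (inj₂ N∣y-a)

    decomposition : HamiltonDecomposition (Cay S)
    decomposition = record { I = Bool ; path = path ; isHam = isHam ; disjoint = disjoint ; covers = covers }
      where
      isHam : ∀ i → IsHamiltonPath (path i)
      isHam true = hamiltonian₁
      isHam false = hamiltonian₂
      disjoint : ∀ i j → i ≢ j → ∀ x y → ¬ (Subgraph.E (path i) x y × Subgraph.E (path j) x y)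
      disjoint true true i≢j _ _ _ = i≢j refl
      disjoint false false i≢j _ _ _ = i≢j refl
      disjoint true false _ _ _ (e₁ , e₂) = complementary e₁ e₂
      disjoint false true _ _ _ (e₂ , e₁) = complementary e₁ e₂

  sufficient : Admissible₂ a b → HamiltonDecomposable (Cay S)
  sufficient (gcd≡1 , a+b-even) with both-odd gcd≡1 a+b-even
  ... | a-odd , b-odd with odd-gap a-odd b-odd a<b
  ... | e , b≡a+d = TwoZigzags.decomposition e b≡a+d a-odd b-odd (ℕC.gcd≡1⇒coprime gcd≡1)

  module HamiltonPath (E : ℤ → ℤ → Set) (E-sym : ∀ {x y} → E x y → E y x) (E-adj : ∀ {x y} → E x y → S (y - x))
                      (twoValent : TwoValent E) (connected : Connected E) where

    E-irrefl : ∀ {x} → ¬ E x x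
    E-irrefl {x} e = S-nonzero (subst S (ℤP.+-inverseʳ x) (E-adj e))

    open Enumeration E E-sym E-irrefl twoValent connected public
    open Traversal

    δ : ℤ → Bool
    δ x = isNeg (first x) xor isNeg (second x)

    δ-along : ∀ k → δ (h k) ≡ isNeg (h (ℤ.pred k)) xor isNeg (h (ℤ.suc k))
    δ-along k = xor-pair isNeg (first≢second (h k)) (neighbours h-traversal k (E-first (h k)))
                                                    (neighbours h-traversal k (E-second (h k)))

    step-bounded : ∀ {x y} → E x y → ∣ y - x ∣ ℕ.≤ b
    step-bounded e = S-bounded (E-adj e)

    near-cut : ∀ {x y} → E x y → isNeg x ≡ true → isNeg y ≡ false → x ∈ window b
    near-cut { -[1+ n ]} {+ m} e _ _ = ∈-window⁺ (ℕP.≤-trans (ℕP.m≤n+m (suc n) m) (step-bounded e))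

    isNeg∧δ⇒∈window : ∀ x → isNeg x ∧ δ x ≡ true → x ∈ window b
    isNeg∧δ⇒∈window x eq with isNeg x in neg
    ... | true = [ near-cut (E-first x) neg , near-cut (E-second x) neg ]′ (xor≡true⇒false eq)

    tail-side : ∀ {H} → Traversal H → ∀ K → (∀ t → b ℕ.< ∣ H (+ (t ℕ.+ K)) ∣) →
                ∀ t → isNeg (H (+ (t ℕ.+ K))) ≡ isNeg (H (+ K))
    tail-side T K far zero = refl
    tail-side T K far (suc t) =
      trans (sym (isNeg-stable (step-bounded (step T (+ (t ℕ.+ K)))) (far t) (far (suc t)))) (tail-side T K far t)

    index : ℤ → ℤ
    index v = proj₁ (h-surjective v)

    K : ℕ
    K = suc (proj₁ (bounded-on-ball index b))

    index-near : ∀ {v} → ∣ v ∣ ℕ.≤ b → ∣ index v ∣ ℕ.< K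
    index-near {v} v≤b = ℕ.s≤s (proj₂ (bounded-on-ball index b) v v≤b)

    far : ∀ k → K ℕ.≤ ∣ k ∣ → b ℕ.< ∣ h k ∣
    far k K≤k with b ℕ.<? ∣ h k ∣
    ... | yes b<hk = b<hk
    ... | no b≮hk = ⊥-elim (ℕP.<⇒≱ k<K K≤k)
      where
      k<K : ∣ k ∣ ℕ.< K
      k<K = subst (λ i → ∣ i ∣ ℕ.< K) (h-injective {index (h k)} {k} (proj₂ (h-surjective (h k)))) (index-near {h k} (ℕP.≮⇒≥ b≮hk))

    σ₊ σ₋ : Bool
    σ₊ = isNeg (h (+ K))
    σ₋ = isNeg (h (- + K))

    right-tail : ∀ t → isNeg (h (+ (t ℕ.+ K))) ≡ σ₊
    right-tail = tail-side h-traversal K (λ t → far (+ (t ℕ.+ K)) (ℕP.m≤n+m K t))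

    left-tail : ∀ t → isNeg (h (- + (t ℕ.+ K))) ≡ σ₋
    left-tail = tail-side (reflect h-traversal) K (λ t → far (- + (t ℕ.+ K)) (subst (K ℕ.≤_) (sym (ℤP.∣-i∣≡∣i∣ (+ (t ℕ.+ K)))) (ℕP.m≤n+m K t)))

    far-side : ∀ k → K ℕ.≤ ∣ k ∣ → isNeg (h k) ≡ σ₊ ⊎ isNeg (h k) ≡ σ₋
    far-side (+ n) K≤n = inj₁ (subst (λ m → isNeg (h (+ m)) ≡ σ₊) (ℕP.m∸n+n≡m K≤n) (right-tail (n ℕ.∸ K)))
    far-side -[1+ n ] K≤n = inj₂ (subst (λ m → isNeg (h (- + m)) ≡ σ₋) (ℕP.m∸n+n≡m K≤n) (left-tail (suc n ℕ.∸ K)))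

    -- Otherwise all far vertices lie on one side, and the near ones are bounded: h would miss a whole half-line.
    tails-differ : σ₊ ≢ σ₋
    tails-differ σ₊≡σ₋ = escape σ₊ refl
      where
      M : ℕ
      M = proj₁ (bounded-on-ball h K)
      missed : ∀ v → isNeg v ≢ σ₊ → M ℕ.< ∣ v ∣ → ⊥
      missed v side big with h-surjective v
      ... | k , refl with K ℕ.≤? ∣ k ∣
      ...   | yes K≤k = side ([ id , (λ e → trans e (sym σ₊≡σ₋)) ]′ (far-side k K≤k))
      ...   | no K≰k = ℕP.<⇒≱ big (proj₂ (bounded-on-ball h K) k (ℕP.<⇒≤ (ℕP.≰⇒> K≰k)))
      escape : ∀ c → σ₊ ≡ c → ⊥
      escape true σ₊≡true = missed (+ suc M) (λ e → true≢false (sym (trans e σ₊≡true))) (ℕP.n<1+n M)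
      escape false σ₊≡false = missed -[1+ M ] (λ e → true≢false (trans e σ₊≡false)) (ℕP.n<1+n M)

    indices : List ℤ
    indices = interval (- + K) (suc (K ℕ.+ K))

    -K+[2K+1] : - + K + + suc (K ℕ.+ K) ≡ + suc K
    -K+[2K+1] = trans (cong (λ z → - + K + z) (trans (ℤP.pos-+ 1 (K ℕ.+ K)) (cong (λ z → 1ℤ + z) (ℤP.pos-+ K K)))) (solve (+ K))
      where solve : ∀ k → - k + (1ℤ + (k + k)) ≡ 1ℤ + k
            solve = solve-∀

    ∈-indices : ∀ {k} → ∣ k ∣ ℕ.< K → k ∈ indices
    ∈-indices {+ n} n<K = ∈-interval⁺ {n = suc (K ℕ.+ K)} ℤP.neg-≤-pos (subst (+ n ℤ.<_) (sym -K+[2K+1]) (ℤ.+<+ (ℕ.s≤s (ℕP.<⇒≤ n<K))))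
    ∈-indices { -[1+ n ]} n<K = ∈-interval⁺ {n = suc (K ℕ.+ K)} (ℤP.neg-mono-≤ (ℤ.+≤+ (ℕP.<⇒≤ n<K))) (subst (-[1+ n ] ℤ.<_) (sym -K+[2K+1]) ℤ.-<+)

    negative-edge : ℤ → Bool
    negative-edge k = isNeg (h (ℤ.pred k)) ∧ isNeg (h k)

    isNeg∧δ-telescopes : ∀ k → isNeg (h k) ∧ δ (h k) ≡ negative-edge k xor negative-edge (ℤ.suc k)
    isNeg∧δ-telescopes k = begin
      isNeg (h k) ∧ δ (h k)                                      ≡⟨ cong (isNeg (h k) ∧_) (δ-along k) ⟩
      isNeg (h k) ∧ (isNeg (h (ℤ.pred k)) xor isNeg (h (ℤ.suc k))) ≡⟨ ∧-distribˡ-xor (isNeg (h k)) _ _ ⟩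
      (isNeg (h k) ∧ isNeg (h (ℤ.pred k))) xor (isNeg (h k) ∧ isNeg (h (ℤ.suc k)))
        ≡⟨ cong₂ _xor_ (∧-comm (isNeg (h k)) _) (cong (λ j → isNeg (h j) ∧ isNeg (h (ℤ.suc k))) (sym (ℤP.pred-suc k))) ⟩
      negative-edge k xor negative-edge (ℤ.suc k)                                        ∎
      where open ≡-Reasoning

    cut-parity : ⨁ (window b) δ ≡ true
    cut-parity = begin
      ⨁ (window b) δ                               ≡⟨ ⨁-cong (window b) (λ {x} x∈ → cong (_∧ δ x) (sym (window-isNeg x∈))) ⟩
      ⨁ (window b) (λ x → isNeg x ∧ δ x)           ≡⟨ sym (⨁-reindex ℤ._≟_ ℤ._≟_ h (λ x → isNeg x ∧ δ x) (interval-unique _ _) (interval-unique _ _) h-injective into onto) ⟩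
      ⨁ indices (λ k → isNeg (h k) ∧ δ (h k))     ≡⟨ ⨁-cong indices (λ {k} _ → isNeg∧δ-telescopes k) ⟩
      ⨁ indices (λ k → negative-edge k xor negative-edge (ℤ.suc k))        ≡⟨ ⨁-telescope negative-edge (- + K) (suc (K ℕ.+ K)) ⟩
      negative-edge (- + K) xor negative-edge (- + K + + suc (K ℕ.+ K))    ≡⟨ cong₂ _xor_ left-end right-end ⟩
      σ₋ xor σ₊                                    ≡⟨ xor-≢ (tails-differ ∘′ sym) ⟩
      true                                         ∎
      where
      open ≡-Reasoning
      into : ∀ {k} → k ∈ indices → isNeg (h k) ∧ δ (h k) ≡ true → h k ∈ window b
      into {k} _ = isNeg∧δ⇒∈window (h k)
      onto : ∀ {y} → y ∈ window b → isNeg y ∧ δ y ≡ true → ∃[ k ] k ∈ indices × h k ≡ y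
      onto {y} y∈ _ with ∈-window⁻ y∈
      ... | n , 1+n≤b , refl = index y , ∈-indices (index-near 1+n≤b) , proj₂ (h-surjective y)
      left-end : negative-edge (- + K) ≡ σ₋
      left-end = trans (cong (_∧ σ₋) (left-tail 1)) (∧-idem σ₋)
      right-end : negative-edge (- + K + + suc (K ℕ.+ K)) ≡ σ₊
      right-end = trans (cong negative-edge -K+[2K+1]) (trans (cong (σ₊ ∧_) (right-tail 1)) (∧-idem σ₊))

    gcd≡1 : gcd a b ≡ 1
    gcd≡1 = ℕD.∣1⇒≡1 (∣⇒∣ᵤ (walk-divisible (λ e → S-divisible (E-adj e)) (connected 0ℤ 1ℤ)))

  candidates-adjacent : ∀ {x y} → y ∈ candidates x → S (y - x)
  candidates-adjacent {x} (here refl) = inj₁ (solve x (+ a))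
    where solve : ∀ x c → x + c - x ≡ c
          solve = solve-∀
  candidates-adjacent {x} (there (here refl)) = inj₂ (inj₁ (solve x (+ a)))
    where solve : ∀ x c → x - c - x ≡ - c
          solve = solve-∀
  candidates-adjacent {x} (there (there (here refl))) = inj₂ (inj₂ (inj₁ (solve x (+ b))))
    where solve : ∀ x c → x + c - x ≡ c
          solve = solve-∀
  candidates-adjacent {x} (there (there (there (here refl)))) = inj₂ (inj₂ (inj₂ (solve x (+ b))))
    where solve : ∀ x c → x - c - x ≡ - c
          solve = solve-∀

  module Decomposition (HD : HamiltonDecomposition (Cay S)) where
    open HamiltonDecomposition HD

    module Path (i : I) = HamiltonPath (Subgraph.E (path i)) (Subgraph.E-sym (path i)) (Subgraph.E⊆Adj (path i))
                                       (proj₁ (isHam i)) (proj₂ (isHam i))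

    i₀ : I
    i₀ = proj₁ (covers 0ℤ (+ a) (inj₁ (ℤP.+-identityʳ (+ a))))

    module P₀ = Path i₀

    private
      outside : ∃[ c ] c ∈ candidates 0ℤ × c ∉ P₀.first 0ℤ ∷ P₀.second 0ℤ ∷ []
      outside = ∃-outside ℤ._≟_ (candidates-unique 0ℤ) (ℕ.s≤s (ℕ.s≤s (ℕ.s≤s ℕ.z≤n)))
      c : ℤ
      c = proj₁ outside
      c-adjacent : S (c - 0ℤ)
      c-adjacent = candidates-adjacent {0ℤ} (proj₁ (proj₂ outside))

    -- A second path, through an edge at 0 that the first one does not use.
    i₁ : I
    i₁ = proj₁ (covers 0ℤ c c-adjacent)

    module P₁ = Path i₁

    i₀≢i₁ : i₀ ≢ i₁
    i₀≢i₁ i₀≡i₁ with P₀.E-only 0ℤ (subst (λ i → Subgraph.E (path i) 0ℤ c) (sym i₀≡i₁) (proj₂ (covers 0ℤ c c-adjacent)))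
    ... | inj₁ c≡u = proj₂ (proj₂ outside) (here c≡u)
    ... | inj₂ c≡w = proj₂ (proj₂ outside) (there (here c≡w))

    module _ (x : ℤ) where

      private
        E₀ E₁ : ℤ → ℤ → Set
        E₀ = Subgraph.E (path i₀)
        E₁ = Subgraph.E (path i₁)

        distinct : ∀ {u w} → E₀ x u → E₁ x w → u ≢ w
        distinct e₀ e₁ refl = disjoint i₀ i₁ i₀≢i₁ x _ (e₀ , e₁)

      neighbours : List ℤ
      neighbours = P₀.first x ∷ P₀.second x ∷ P₁.first x ∷ P₁.second x ∷ []

      neighbours-unique : Unique neighbours
      neighbours-unique =
          (P₀.first≢second x ∷ distinct (P₀.E-first x) (P₁.E-first x) ∷ distinct (P₀.E-first x) (P₁.E-second x) ∷ [])
        ∷ (distinct (P₀.E-second x) (P₁.E-first x) ∷ distinct (P₀.E-second x) (P₁.E-second x) ∷ [])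
        ∷ (P₁.first≢second x ∷ [])
        ∷ [] ∷ []

      neighbours⊆candidates : ∀ {y} → y ∈ neighbours → y ∈ candidates x
      neighbours⊆candidates = All.lookup (near (P₀.E-first x) ∷ near (P₀.E-second x) ∷ near (P₁.E-first x) ∷ near (P₁.E-second x) ∷ [])
        where
        near : ∀ {i y} → Subgraph.E (path i) x y → y ∈ candidates x
        near {i} {y} e = ∈-candidates {x} {y} (Subgraph.E⊆Adj (path i) e)

      candidates⊆neighbours : ∀ {y} → y ∈ candidates x → y ∈ neighbours
      candidates⊆neighbours = ⊆-saturated ℤ._≟_ neighbours-unique neighbours⊆candidates ℕP.≤-refl

      δ-partition : P₀.δ x xor P₁.δ x ≡ ⨁ (candidates x) isNeg
      δ-partition = trans (regroup (isNeg (P₀.first x)) (isNeg (P₀.second x)) (isNeg (P₁.first x)) (isNeg (P₁.second x)))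
                          (⨁-sameSet ℤ._≟_ isNeg neighbours-unique (candidates-unique x) neighbours⊆candidates candidates⊆neighbours)
        where
        regroup : ∀ p q r s → (p xor q) xor (r xor s) ≡ p xor (q xor (r xor (s xor false)))
        regroup p q r s = trans (xor-assoc p q _) (cong (λ t → p xor (q xor (r xor t))) (sym (xor-identityʳ s)))

      δ-on-window : x ∈ window b → P₀.δ x xor P₁.δ x ≡ isNeg (x + + a) xor isNeg (x + + b)
      δ-on-window x∈ with ∈-window⁻ x∈
      ... | n , _ , refl = trans δ-partition (collapse (isNeg (-[1+ n ] + + a)) (isNeg (-[1+ n ] + + b)) (left-neg a) (left-neg b))
        where
        left-neg : ∀ c → isNeg (-[1+ n ] - + c) ≡ true
        left-neg zero = refl
        left-neg (suc c) = refl
        collapse : ∀ p q {r s} → r ≡ true → s ≡ true → p xor (r xor (q xor (s xor false))) ≡ p xor q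
        collapse true true refl refl = refl
        collapse true false refl refl = refl
        collapse false true refl refl = refl
        collapse false false refl refl = refl

    a+b-even : (a ℕ.+ b) % 2 ≡ 0
    a+b-even = even-gap⇒even-sum (ℕP.<⇒≤ a<b) (begin
      isOdd (b ℕ.∸ a)                                      ≡⟨ sym (xor-identityʳ _) ⟩
      isOdd (b ℕ.∸ a) xor isOdd 0                         ≡⟨ sym (cong₂ _xor_ shift-a (⨁-window-shift 0 b)) ⟩
      ⨁ W (λ x → isNeg (x + + a)) xor ⨁ W (λ x → isNeg (x + + b)) ≡⟨ sym (⨁-xor W _ _) ⟩
      ⨁ W (λ x → isNeg (x + + a) xor isNeg (x + + b))     ≡⟨ sym (⨁-cong W (λ {x} → δ-on-window x)) ⟩
      ⨁ W (λ x → P₀.δ x xor P₁.δ x)                         ≡⟨ ⨁-xor W P₀.δ P₁.δ ⟩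
      ⨁ W P₀.δ xor ⨁ W P₁.δ                                 ≡⟨ cong₂ _xor_ P₀.cut-parity P₁.cut-parity ⟩
      false                                                 ∎)
      where
      open ≡-Reasoning
      W : List ℤ
      W = window b
      shift-a : ⨁ W (λ x → isNeg (x + + a)) ≡ isOdd (b ℕ.∸ a)
      shift-a = subst (λ n → ⨁ (window n) (λ x → isNeg (x + + a)) ≡ isOdd (b ℕ.∸ a)) (ℕP.m∸n+n≡m (ℕP.<⇒≤ a<b)) (⨁-window-shift (b ℕ.∸ a) a)

  necessary : HamiltonDecomposable (Cay S) → Admissible₂ a b
  necessary HD = Decomposition.P₀.gcd≡1 HD , Decomposition.a+b-even HD

theorem9 : (a b : ℕ) → 0 < a → a < b →
    HamiltonDecomposable (Cay (S₂ a b)) ⇔ Admissible₂ a b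
theorem9 a b 0<a a<b = mk⇔ (Cayley.necessary a b 0<a a<b) (Cayley.sufficient a b 0<a a<b)
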